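{- Let $p$ and $q$ be two distinct primes with $p<q$ and let $G$ be a cyclic group of order $p^2q^2$. Then \begin{align*} M_1(\mathcal{B}(G))={}&p^8q^8-2p^6q^8-2p^8q^6-4p^4q^6-4p^6q^4-2p^2q^8-2p^8q^2+2p^4q^8+2p^8q^4+4p^6q^6\\ &+5p^4q^4+4p^2q^6+4p^6q^2-4p^2q^4-4p^4q^2+4p^2q^2+2q^8+2p^8-4q^6-4p^6\\ &+4q^4+4p^4-4p^2-4q^2+4,\\ M_2(\mathcal{B}(G))={}&p^8q^8-2p^6q^8-2p^8q^6-4p^4q^6-4p^6q^4-2p^2q^8-2p^8q^2+2p^4q^8+2p^8q^4+4p^6q^6\\ &+4p^4q^4+4p^2q^6+4p^6q^2-4p^2q^4-4p^4q^2+4p^2q^2+2q^8+2p^8-4q^6-4p^6\\ &+4q^4+4p^4-4p^2-4q^2+4, \end{align*} and \[ \frac{M_{2}(\mathcal{B}(G))}{\vert e(\mathcal{B}(G))\vert} > \frac{M_{1}(\mathcal{B}(G))}{\vert V(\mathcal{B}(G)) \vert}. \]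
   Context: For a finite group $G$, let $L(G)$ be the set of all subgroups of $G$. The SGB-graph $\mathcal{B}(G)$ is the bipartite graph with vertex set $V(\mathcal{B}(G))=(G\times G)\sqcup L(G)$, in which $(a,b)\in G\times G$ is adjacent to $H\in L(G)$ if and only if $H=\langle a,b\rangle$; there are no other edges. For a simple graph $\mathcal{G}$ with vertex set $V(\mathcal{G})$ and edge set $e(\mathcal{G})$, the first and second Zagreb indices are $M_1(\mathcal{G})=\sum_{v\in V(\mathcal{G})}\deg(v)^2$ and $M_2(\mathcal{G})=\sum_{uv\in e(\mathcal{G})}\deg(u)\deg(v)$. -}

module Defs where

open import Level using (0ℓ)
open import Data.Nat using (ℕ; zero; suc; _+_; _*_; _^_)
open import Data.Fin using (Fin)
open import Data.Fin.Subset using (Subset; _∈_; _⊆_; inside; outside)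
open import Data.Fin.Subset.Properties using (_∈?_; _⊆?_; anySubset?)
open import Data.Fin.Properties using (all?)
open import Data.Vec using ([]; _∷_)
open import Data.Nat.ListAction using (sum)
open import Data.List using (List; []; _∷_; map; _++_; filter; length; cartesianProduct; allFin; concatMap)
open import Data.Product using (_×_; _,_; Σ; ∃; proj₁)
open import Data.Sum using (_⊎_; inj₁; inj₂)
open import Relation.Nullary using (¬_; Dec; yes; no; _×-dec_)
open import Relation.Nullary.Decidable using (decidable-stable; ¬?)
open import Relation.Binary.PropositionalEquality using (_≡_)
open import Algebra.Core using (Op₁; Op₂)
open import Algebra.Structures using (IsGroup)

-- A finite group of order n, presented on the carrier Fin n
-- (every finite group of order n is isomorphic to such a structure).

module _ {n : ℕ} (_∙_ : Op₂ (Fin n)) (ε : Fin n) (_⁻¹ : Op₁ (Fin n)) where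

  pow : Fin n → ℕ → Fin n
  pow g zero    = ε
  pow g (suc k) = g ∙ pow g k

  IsCyclic : Set
  IsCyclic = ∃ λ (g : Fin n) → ∀ (x : Fin n) → ∃ λ (k : ℕ) → x ≡ pow g k

  IsSubgroup : Subset n → Set
  IsSubgroup H = (ε ∈ H)
               × (∀ (x y : Fin n) → x ∈ H → y ∈ H → (x ∙ y) ∈ H)
               × (∀ (x : Fin n) → x ∈ H → (x ⁻¹) ∈ H)

  IsGeneratedBy : Subset n → Fin n → Fin n → Set
  IsGeneratedBy H a b = IsSubgroup H × a ∈ H × b ∈ H
                      × (∀ (K : Subset n) → IsSubgroup K → a ∈ K → b ∈ K → H ⊆ K)

  private
    impl? : {A B : Set} → Dec A → Dec B → Dec (A → B)
    impl? (yes a) (yes b) = yes (λ _ → b)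
    impl? (yes a) (no ¬b) = no (λ f → ¬b (f a))
    impl? (no ¬a) _       = yes (λ a → Data.Empty.⊥-elim (¬a a))
      where import Data.Empty

  isSubgroup? : (H : Subset n) → Dec (IsSubgroup H)
  isSubgroup? H =
    (ε ∈? H)
    ×-dec all? (λ x → all? (λ y → impl? (x ∈? H) (impl? (y ∈? H) ((x ∙ y) ∈? H))))
    ×-dec all? (λ x → impl? (x ∈? H) ((x ⁻¹) ∈? H))

  private
    minimal? : (H : Subset n) (a b : Fin n) (K : Subset n) →
               Dec (IsSubgroup K → a ∈ K → b ∈ K → H ⊆ K)
    minimal? H a b K = impl? (isSubgroup? K) (impl? (a ∈? K) (impl? (b ∈? K) (H ⊆? K)))

    allSub? : {P : Subset n → Set} → (∀ K → Dec (P K)) → Dec (∀ K → P K)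
    allSub? {P} P? with anySubset? (λ K → ¬? (P? K))
    ... | yes (K , ¬pK) = no (λ f → ¬pK (f K))
    ... | no ¬ex = yes (λ K → decidable-stable (P? K) (λ ¬pK → ¬ex (K , ¬pK)))

  isGeneratedBy? : (H : Subset n) (a b : Fin n) → Dec (IsGeneratedBy H a b)
  isGeneratedBy? H a b =
    isSubgroup? H ×-dec (a ∈? H) ×-dec (b ∈? H) ×-dec allSub? (minimal? H a b)

allSubsets : (n : ℕ) → List (Subset n)
allSubsets zero    = [] ∷ []
allSubsets (suc n) = map (inside ∷_) (allSubsets n) ++ map (outside ∷_) (allSubsets n)

-- The SGB-graph B(G): vertices (G × G) ⊔ L(G), (a,b) ~ H iff H = ⟨a,b⟩.

module SGB {n : ℕ} (_∙_ : Op₂ (Fin n)) (ε : Fin n) (_⁻¹ : Op₁ (Fin n)) where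

  pairs : List (Fin n × Fin n)
  pairs = cartesianProduct (allFin n) (allFin n)

  subgroups : List (Subset n)
  subgroups = filter (isSubgroup? _∙_ ε _⁻¹) (allSubsets n)

  Vertex : Set
  Vertex = (Fin n × Fin n) ⊎ Subset n

  vertices : List Vertex
  vertices = map inj₁ pairs ++ map inj₂ subgroups

  Adjacent : Fin n × Fin n → Subset n → Set
  Adjacent (a , b) H = IsGeneratedBy _∙_ ε _⁻¹ H a b

  adjacent? : (ab : Fin n × Fin n) (H : Subset n) → Dec (Adjacent ab H)
  adjacent? (a , b) H = isGeneratedBy? _∙_ ε _⁻¹ H a b

  edges : List ((Fin n × Fin n) × Subset n)
  edges = filter (λ e → adjacent? (Data.Product.proj₁ e) (Data.Product.proj₂ e))
                 (cartesianProduct pairs subgroups)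
    where import Data.Product

  degree : Vertex → ℕ
  degree (inj₁ ab) = length (filter (adjacent? ab) subgroups)
  degree (inj₂ H)  = length (filter (λ ab → adjacent? ab H) pairs)

  M₁ : ℕ
  M₁ = sum (map (λ v → degree v ^ 2) vertices)

  M₂ : ℕ
  M₂ = sum (map (λ e → degree (inj₁ (proj₁ e)) * degree (inj₂ (Data.Product.proj₂ e))) edges)
    where import Data.Product

  numVertices : ℕ
  numVertices = length vertices

  numEdges : ℕ
  numEdges = length edges

{-# OPTIONS --safe #-}
module Submission where

-- Every pair (a , b) generates exactly one subgroup, so every pair-vertex of B(G) has degree 1:
-- |E| = n², M₂ = Σ_H deg(H)² and M₁ = n² + Σ_H deg(H)², with n = |G|.
-- In the cyclic group of order n = p^α q^β the subgroups are H_d = {x | d ∣ log x} for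
-- d = p^a q^b (a ≤ α, b ≤ β), and (x , y) generates H_d iff both lie in H_d but not both in
-- one of its maximal subgroups H_{pd}, H_{qd}.  Inclusion–exclusion over these two then makes
-- deg(H_d) a product of a p-factor and a q-factor, so Σ_H deg(H)² = F(p) F(q) with
-- F(r) = r⁸ − 2r⁶ + 2r⁴ − 2r² + 2 when α = β = 2.  Since M₁/|V| < M₂/|E| amounts to
-- p⁸q⁸ < 9 F(p) F(q), the inequality follows from r⁸ < 3 F(r).

module Counting where

  open import Level using (0ℓ)
  open import Data.Nat using (ℕ; suc; _+_; _*_)
  open import Data.Nat.Properties using (*-distribʳ-+; *-distribˡ-+; *-zeroʳ; *-identityʳ; +-identityʳ)
  open import Data.Nat.ListAction using (sum)
  open import Data.Nat.ListAction.Properties using (sum-++)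
  open import Data.Nat.Tactic.RingSolver using (solve-∀)
  open import Data.Fin using (Fin)
  open import Data.List using (List; []; _∷_; map; _++_; filter; length; cartesianProduct; allFin)
  open import Data.List.Properties
    using (length-++; length-map; length-tabulate; filter-++; filter-≐; filter-none; map-++; map-cong; map-∘)
  open import Data.List.Membership.Propositional using (_∈_)
  open import Data.List.Membership.Propositional.Properties using (∈-filter⁺; ∈-filter⁻; ∈-map⁺; ∈-map⁻; ∈-allFin)
  open import Data.List.Membership.Propositional.Properties.WithK using (unique∧set⇒bag)
  open import Data.List.Relation.Unary.Any using (here; there)
  open import Data.List.Relation.Unary.All as All using ()
  open import Data.List.Relation.Unary.Unique.Propositional using (Unique; _∷_)
  open import Data.List.Relation.Unary.Unique.Propositional.Properties using (filter⁺; map⁺; allFin⁺)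
  open import Data.List.Relation.Binary.Permutation.Propositional.Properties using (↭-length)
  open import Data.List.Relation.Binary.BagAndSetEquality using (∼bag⇒↭)
  open import Data.Product using (_×_; _,_; proj₁; proj₂; ∃)
  open import Function.Base using (id; _∘_)
  open import Function.Bundles using (_⇔_; mk⇔; module Equivalence)
  open import Function.Definitions using (Injective)
  open import Relation.Nullary using (¬_; Dec; yes; no; _×-dec_; ¬?; contradiction)
  open import Relation.Unary using (Pred; Decidable; _⊆_; _≐_)
  open import Relation.Binary.PropositionalEquality

  count : {A : Set} {P : Pred A 0ℓ} → Decidable P → List A → ℕ
  count P? xs = length (filter P? xs)

  indicator : {P : Set} → Dec P → ℕ
  indicator (yes _) = 1
  indicator (no _)  = 0

  length-cartesianProduct : {A B : Set} (xs : List A) (ys : List B) →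
                            length (cartesianProduct xs ys) ≡ length xs * length ys
  length-cartesianProduct []       ys = refl
  length-cartesianProduct (x ∷ xs) ys = begin
    length (map (x ,_) ys ++ cartesianProduct xs ys)          ≡⟨ length-++ (map (x ,_) ys) ⟩
    length (map (x ,_) ys) + length (cartesianProduct xs ys)  ≡⟨ cong₂ _+_ (length-map (x ,_) ys)
                                                                           (length-cartesianProduct xs ys) ⟩
    length ys + length xs * length ys                         ∎
    where open ≡-Reasoning

  count-≐ : {A : Set} {P Q : Pred A 0ℓ} (P? : Decidable P) (Q? : Decidable Q) → P ≐ Q →
            (xs : List A) → count P? xs ≡ count Q? xs
  count-≐ P? Q? P≐Q xs = cong length (filter-≐ P? Q? P≐Q xs)

  count-map : {A B : Set} {P : Pred B 0ℓ} (P? : Decidable P) (f : A → B) (xs : List A) →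
              count P? (map f xs) ≡ count (P? ∘ f) xs
  count-map P? f []       = refl
  count-map P? f (x ∷ xs) with P? (f x)
  ... | yes _ = cong suc (count-map P? f xs)
  ... | no _  = count-map P? f xs

  module _ {A : Set} {P : Pred A 0ℓ} (P? : Decidable P) where

    count-∷ : (x : A) (xs : List A) → count P? (x ∷ xs) ≡ indicator (P? x) + count P? xs
    count-∷ x xs with P? x
    ... | yes _ = refl
    ... | no _  = refl

    count-++ : (xs ys : List A) → count P? (xs ++ ys) ≡ count P? xs + count P? ys
    count-++ xs ys = trans (cong length (filter-++ P? xs ys)) (length-++ (filter P? xs))

    count-none : (xs : List A) → (∀ x → ¬ P x) → count P? xs ≡ 0
    count-none xs ¬P = cong length (filter-none P? (All.universal ¬P xs))

    count-unique : ∀ {y} {xs : List A} → Unique xs → y ∈ xs → P y → (∀ {x} → P x → x ≡ y) →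
                   count P? xs ≡ 1
    count-unique {xs = x ∷ xs} (x∉xs ∷ !xs) y∈ Py only with P? x | y∈
    ... | yes Px | _          = cong suc (cong length (filter-none P?
                                  (All.map (λ x≢z Pz → x≢z (trans (only Px) (sym (only Pz)))) x∉xs)))
    ... | no ¬Px | here refl  = contradiction Py ¬Px
    ... | no _   | there y∈xs = count-unique !xs y∈xs Py only

    count≡length : {xs ys : List A} → Unique xs → Unique ys →
                   (∀ {z} → z ∈ ys ⇔ (z ∈ xs × P z)) → count P? xs ≡ length ys
    count≡length {xs} {ys} !xs !ys ys⇔ =
      ↭-length (∼bag⇒↭ (unique∧set⇒bag (filter⁺ P? !xs) !ys (mk⇔ to′ from′)))
      where
      to′ : ∀ {z} → z ∈ filter P? xs → z ∈ ys
      to′ z∈ = Equivalence.from ys⇔ (∈-filter⁻ P? z∈)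
      from′ : ∀ {z} → z ∈ ys → z ∈ filter P? xs
      from′ z∈ = let (z∈xs , Pz) = Equivalence.to ys⇔ z∈ in ∈-filter⁺ P? z∈xs Pz

  count-image : ∀ {m n} {P : Pred (Fin n) 0ℓ} (P? : Decidable P) (f : Fin m → Fin n) →
                Injective _≡_ _≡_ f → (∀ {z} → P z ⇔ ∃ λ j → f j ≡ z) → count P? (allFin n) ≡ m
  count-image {m} {n} {P} P? f f-injective P⇔image = begin
    count P? (allFin n)        ≡⟨ count≡length P? (allFin⁺ n) (map⁺ f-injective (allFin⁺ m)) (mk⇔ to′ from′) ⟩
    length (map f (allFin m))  ≡⟨ length-map f (allFin m) ⟩
    length (allFin m)          ≡⟨ length-tabulate id ⟩
    m                          ∎
    where
    open ≡-Reasoning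
    to′ : ∀ {z} → z ∈ map f (allFin m) → z ∈ allFin n × P z
    to′ z∈ = let (j , _ , z≡fj) = ∈-map⁻ f z∈ in ∈-allFin _ , Equivalence.from P⇔image (j , sym z≡fj)
    from′ : ∀ {z} → z ∈ allFin n × P z → z ∈ map f (allFin m)
    from′ (_ , Pz) = let (j , fj≡z) = Equivalence.to P⇔image Pz in subst (_∈ map f (allFin m)) fj≡z (∈-map⁺ f (∈-allFin j))

  module _ {A B : Set} {P : Pred A 0ℓ} {Q : Pred B 0ℓ} (P? : Decidable P) (Q? : Decidable Q) where

    count-cartesianProduct : (xs : List A) (ys : List B) →
      count (λ xy → P? (proj₁ xy) ×-dec Q? (proj₂ xy)) (cartesianProduct xs ys) ≡ count P? xs * count Q? ys
    count-cartesianProduct []       ys = refl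
    count-cartesianProduct (x ∷ xs) ys = begin
      count PQ? (map (x ,_) ys ++ cartesianProduct xs ys)
        ≡⟨ count-++ PQ? (map (x ,_) ys) (cartesianProduct xs ys) ⟩
      count PQ? (map (x ,_) ys) + count PQ? (cartesianProduct xs ys)
        ≡⟨ cong₂ _+_ (trans (count-map PQ? (x ,_) ys) row) (count-cartesianProduct xs ys) ⟩
      indicator (P? x) * count Q? ys + count P? xs * count Q? ys
        ≡⟨ *-distribʳ-+ (count Q? ys) (indicator (P? x)) (count P? xs) ⟨
      (indicator (P? x) + count P? xs) * count Q? ys
        ≡⟨ cong (_* count Q? ys) (count-∷ P? x xs) ⟨
      count P? (x ∷ xs) * count Q? ys ∎
      where
      open ≡-Reasoning
      PQ? : Decidable (λ xy → P (proj₁ xy) × Q (proj₂ xy))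
      PQ? xy = P? (proj₁ xy) ×-dec Q? (proj₂ xy)
      row : count (λ y → P? x ×-dec Q? y) ys ≡ indicator (P? x) * count Q? ys
      row with P? x
      ... | yes Px = trans (count-≐ _ Q? (proj₂ , (Px ,_)) ys) (sym (+-identityʳ _))
      ... | no ¬Px = count-none _ ys (λ _ → ¬Px ∘ proj₁)

  module _ {A : Set} {P Q R : Pred A 0ℓ} (P? : Decidable P) (Q? : Decidable Q) (R? : Decidable R)
           (Q⊆P : Q ⊆ P) (R⊆P : R ⊆ P) where

    count-inclusion-exclusion : (xs : List A) →
      count (λ x → P? x ×-dec ¬? (Q? x) ×-dec ¬? (R? x)) xs + count Q? xs + count R? xs
        ≡ count P? xs + count (λ x → Q? x ×-dec R? x) xs
    count-inclusion-exclusion []       = refl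
    count-inclusion-exclusion (x ∷ xs) = begin
      count Only? (x ∷ xs) + count Q? (x ∷ xs) + count R? (x ∷ xs)
        ≡⟨ cong₂ _+_ (cong₂ _+_ (count-∷ Only? x xs) (count-∷ Q? x xs)) (count-∷ R? x xs) ⟩
      (indicator (Only? x) + count Only? xs) + (indicator (Q? x) + count Q? xs) + (indicator (R? x) + count R? xs)
        ≡⟨ regroup (indicator (Only? x)) (indicator (Q? x)) (indicator (R? x)) _ _ _ ⟩
      (indicator (Only? x) + indicator (Q? x) + indicator (R? x)) + (count Only? xs + count Q? xs + count R? xs)
        ≡⟨ cong₂ _+_ pointwise (count-inclusion-exclusion xs) ⟩
      (indicator (P? x) + indicator (Both? x)) + (count P? xs + count Both? xs)
        ≡⟨ interchange (indicator (P? x)) (indicator (Both? x)) _ _ ⟩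
      (indicator (P? x) + count P? xs) + (indicator (Both? x) + count Both? xs)
        ≡⟨ cong₂ _+_ (count-∷ P? x xs) (count-∷ Both? x xs) ⟨
      count P? (x ∷ xs) + count Both? (x ∷ xs) ∎
      where
      open ≡-Reasoning
      Only? : Decidable (λ x → P x × ¬ Q x × ¬ R x)
      Only? x = P? x ×-dec ¬? (Q? x) ×-dec ¬? (R? x)
      Both? : Decidable (λ x → Q x × R x)
      Both? x = Q? x ×-dec R? x
      regroup : ∀ a b c d e f → (a + d) + (b + e) + (c + f) ≡ (a + b + c) + (d + e + f)
      regroup = solve-∀
      interchange : ∀ a b c d → (a + b) + (c + d) ≡ (a + c) + (b + d)
      interchange = solve-∀
      pointwise : indicator (Only? x) + indicator (Q? x) + indicator (R? x) ≡ indicator (P? x) + indicator (Both? x)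
      pointwise with P? x | Q? x | R? x
      ... | yes _ | yes _  | yes _  = refl
      ... | yes _ | yes _  | no _   = refl
      ... | yes _ | no _   | yes _  = refl
      ... | yes _ | no _   | no _   = refl
      ... | no ¬P | yes Qx | _      = contradiction (Q⊆P Qx) ¬P
      ... | no ¬P | no _   | yes Rx = contradiction (R⊆P Rx) ¬P
      ... | no _  | no _   | no _   = refl

  module _ {A : Set} where

    sum-map-+ : (g h : A → ℕ) (xs : List A) → sum (map (λ x → g x + h x) xs) ≡ sum (map g xs) + sum (map h xs)
    sum-map-+ g h []       = refl
    sum-map-+ g h (x ∷ xs) = trans (cong (g x + h x +_) (sum-map-+ g h xs))
                                   (interchange (g x) (h x) (sum (map g xs)) (sum (map h xs)))
      where
      interchange : ∀ a b c d → (a + b) + (c + d) ≡ (a + c) + (b + d)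
      interchange = solve-∀

    sum-map-*ˡ : (c : ℕ) (g : A → ℕ) (xs : List A) → sum (map (λ x → c * g x) xs) ≡ c * sum (map g xs)
    sum-map-*ˡ c g []       = sym (*-zeroʳ c)
    sum-map-*ˡ c g (x ∷ xs) = trans (cong (c * g x +_) (sum-map-*ˡ c g xs)) (sym (*-distribˡ-+ c (g x) _))

    sum-map-cong : {g h : A → ℕ} → (∀ x → g x ≡ h x) → (xs : List A) → sum (map g xs) ≡ sum (map h xs)
    sum-map-cong g≗h xs = cong sum (map-cong g≗h xs)

    sum-map-one : {g : A → ℕ} → (∀ x → g x ≡ 1) → (xs : List A) → sum (map g xs) ≡ length xs
    sum-map-one g≡1 []       = refl
    sum-map-one g≡1 (x ∷ xs) = cong₂ _+_ (g≡1 x) (sum-map-one g≡1 xs)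

  module _ {A B : Set} where

    sum-map-cartesianProduct : (f : A → ℕ) (g : B → ℕ) (xs : List A) (ys : List B) →
      sum (map (λ xy → f (proj₁ xy) * g (proj₂ xy)) (cartesianProduct xs ys)) ≡ sum (map f xs) * sum (map g ys)
    sum-map-cartesianProduct f g []       ys = refl
    sum-map-cartesianProduct f g (x ∷ xs) ys = begin
      sum (map fg (map (x ,_) ys ++ cartesianProduct xs ys))
        ≡⟨ cong sum (map-++ fg (map (x ,_) ys) (cartesianProduct xs ys)) ⟩
      sum (map fg (map (x ,_) ys) ++ map fg (cartesianProduct xs ys))
        ≡⟨ sum-++ (map fg (map (x ,_) ys)) _ ⟩
      sum (map fg (map (x ,_) ys)) + sum (map fg (cartesianProduct xs ys))
        ≡⟨ cong₂ _+_ (trans (cong sum (sym (map-∘ ys))) (sum-map-*ˡ (f x) g ys))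
                     (sum-map-cartesianProduct f g xs ys) ⟩
      f x * sum (map g ys) + sum (map f xs) * sum (map g ys)
        ≡⟨ *-distribʳ-+ (sum (map g ys)) (f x) (sum (map f xs)) ⟨
      (f x + sum (map f xs)) * sum (map g ys) ∎
      where
      open ≡-Reasoning
      fg : A × B → ℕ
      fg (x , y) = f x * g y

    module _ {R : Pred (A × B) 0ℓ} (R? : Decidable R) where

      count-cartesianProduct-byRows : (xs : List A) (ys : List B) →
        count R? (cartesianProduct xs ys) ≡ sum (map (λ x → count (λ y → R? (x , y)) ys) xs)
      count-cartesianProduct-byRows []       ys = refl
      count-cartesianProduct-byRows (x ∷ xs) ys =
        trans (count-++ R? (map (x ,_) ys) (cartesianProduct xs ys))
              (cong₂ _+_ (count-map R? (x ,_) ys) (count-cartesianProduct-byRows xs ys))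

      sum-filter-cartesianProduct-byColumns : (f : B → ℕ) (xs : List A) (ys : List B) →
        sum (map (f ∘ proj₂) (filter R? (cartesianProduct xs ys)))
          ≡ sum (map (λ y → f y * count (λ x → R? (x , y)) xs) ys)
      sum-filter-cartesianProduct-byColumns f []       ys =
        sym (trans (sum-map-cong (λ y → *-zeroʳ (f y)) ys) (sum-zeros ys))
        where
        sum-zeros : (ys : List B) → sum (map (λ _ → 0) ys) ≡ 0
        sum-zeros []       = refl
        sum-zeros (_ ∷ ys) = sum-zeros ys
      sum-filter-cartesianProduct-byColumns f (x ∷ xs) ys = begin
        sum (map (f ∘ proj₂) (filter R? (map (x ,_) ys ++ cartesianProduct xs ys)))
          ≡⟨ cong (sum ∘ map (f ∘ proj₂)) (filter-++ R? (map (x ,_) ys) (cartesianProduct xs ys)) ⟩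
        sum (map (f ∘ proj₂) (filter R? (map (x ,_) ys) ++ filter R? (cartesianProduct xs ys)))
          ≡⟨ cong sum (map-++ (f ∘ proj₂) (filter R? (map (x ,_) ys)) _) ⟩
        sum (map (f ∘ proj₂) (filter R? (map (x ,_) ys)) ++ map (f ∘ proj₂) (filter R? (cartesianProduct xs ys)))
          ≡⟨ sum-++ (map (f ∘ proj₂) (filter R? (map (x ,_) ys))) _ ⟩
        sum (map (f ∘ proj₂) (filter R? (map (x ,_) ys))) + sum (map (f ∘ proj₂) (filter R? (cartesianProduct xs ys)))
          ≡⟨ cong₂ _+_ (row ys) (sum-filter-cartesianProduct-byColumns f xs ys) ⟩
        sum (map (λ y → f y * indicator (R? (x , y))) ys) + sum (map (λ y → f y * count (λ x → R? (x , y)) xs) ys)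
          ≡⟨ sum-map-+ _ _ ys ⟨
        sum (map (λ y → f y * indicator (R? (x , y)) + f y * count (λ x → R? (x , y)) xs) ys)
          ≡⟨ sum-map-cong (λ y → trans (sym (*-distribˡ-+ (f y) _ _))
                                       (cong (f y *_) (sym (count-∷ (λ x → R? (x , y)) x xs)))) ys ⟩
        sum (map (λ y → f y * count (λ x → R? (x , y)) (x ∷ xs)) ys) ∎
        where
        open ≡-Reasoning
        row : (ys : List B) → sum (map (f ∘ proj₂) (filter R? (map (x ,_) ys)))
                             ≡ sum (map (λ y → f y * indicator (R? (x , y))) ys)
        row []       = refl
        row (y ∷ ys) with R? (x , y)
        ... | yes _ = cong₂ _+_ (sym (*-identityʳ (f y))) (row ys)
        ... | no _  = trans (row ys) (cong (_+ sum (map (λ y → f y * indicator (R? (x , y))) ys)) (sym (*-zeroʳ (f y))))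

module GeneratedSubgroups where

  open import Defs
  open Counting
  open import Level using (0ℓ)
  open import Data.Bool using (true; false)
  open import Data.Nat using (ℕ; zero; suc; _+_; _*_; _^_)
  open import Data.Nat.Properties using (*-identityˡ; *-identityʳ)
  open import Data.Nat.ListAction using (sum)
  open import Data.Nat.ListAction.Properties using (sum-++)
  open import Data.Fin using (Fin)
  open import Data.Fin.Subset using (Subset; _∈_; _⊆_; inside; outside)
  open import Data.Fin.Subset.Properties using (_∈?_; anySubset?; ⊆-antisym)
  open import Data.Vec using ([]; _∷_; tabulate)
  open import Data.Vec.Properties using (∷-injectiveʳ; lookup∘tabulate; []=⇒lookup; lookup⇒[]=)
  open import Data.List using (map; _++_; length; cartesianProduct; allFin)
  open import Data.List.Properties using (length-++; length-map; length-tabulate; map-++; map-∘)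
  open import Data.List.Membership.Propositional using () renaming (_∈_ to _∈ₗ_)
  open import Data.List.Membership.Propositional.Properties using (∈-++⁺ˡ; ∈-++⁺ʳ; ∈-map⁺; ∈-map⁻; ∈-filter⁺)
  open import Data.List.Relation.Unary.Any using (here)
  open import Data.List.Relation.Unary.All using ([])
  open import Data.List.Relation.Unary.Unique.Propositional using (Unique; []; _∷_)
  open import Data.List.Relation.Unary.Unique.Propositional.Properties using (++⁺; map⁺; filter⁺)
  open import Data.Product using (_×_; _,_; proj₁; proj₂)
  open import Data.Sum using (inj₁; inj₂)
  open import Function.Base using (id; _∘_)
  open import Relation.Nullary using (¬_; Dec; yes; no; does; ¬?; _→-dec_; contradiction)
  open import Relation.Nullary.Decidable using (decidable-stable)
  open import Relation.Unary using (Pred; Decidable)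
  open import Relation.Binary.PropositionalEquality
  open import Algebra.Core using (Op₁; Op₂)

  subsetOf : ∀ {n} {P : Pred (Fin n) 0ℓ} → Decidable P → Subset n
  subsetOf P? = tabulate (λ x → does (P? x))

  module _ {n} {P : Pred (Fin n) 0ℓ} (P? : Decidable P) where

    ∈-subsetOf⁻ : ∀ {x} → x ∈ subsetOf P? → P x
    ∈-subsetOf⁻ {x} x∈ with P? x | trans (sym (lookup∘tabulate (λ x → does (P? x)) x)) ([]=⇒lookup x∈)
    ... | yes Px | _ = Px

    ∈-subsetOf⁺ : ∀ {x} → P x → x ∈ subsetOf P?
    ∈-subsetOf⁺ {x} Px = lookup⇒[]= x _ (trans (lookup∘tabulate (λ x → does (P? x)) x) (accept (P? x)))
      where
      accept : (d : Dec (P x)) → does d ≡ true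
      accept (yes _)  = refl
      accept (no ¬Px) = contradiction Px ¬Px

  allSubsets-complete : ∀ {n} (K : Subset n) → K ∈ₗ allSubsets n
  allSubsets-complete []                  = here refl
  allSubsets-complete {suc n} (true ∷ K)  = ∈-++⁺ˡ (∈-map⁺ (inside ∷_) (allSubsets-complete K))
  allSubsets-complete {suc n} (false ∷ K) =
    ∈-++⁺ʳ (map (inside ∷_) (allSubsets n)) (∈-map⁺ (outside ∷_) (allSubsets-complete K))

  allSubsets-unique : ∀ n → Unique (allSubsets n)
  allSubsets-unique zero    = [] ∷ []
  allSubsets-unique (suc n) =
    ++⁺ (map⁺ ∷-injectiveʳ (allSubsets-unique n)) (map⁺ ∷-injectiveʳ (allSubsets-unique n)) disjoint
    where
    disjoint : ∀ {K} → ¬ (K ∈ₗ map (inside ∷_) (allSubsets n) × K ∈ₗ map (outside ∷_) (allSubsets n))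
    disjoint (K∈ᵢ , K∈ₒ) with ∈-map⁻ (inside ∷_) K∈ᵢ | ∈-map⁻ (outside ∷_) K∈ₒ
    ... | _ , _ , refl | _ , _ , ()

  ∀Subset? : ∀ {n} {P : Pred (Subset n) 0ℓ} → Decidable P → Dec (∀ K → P K)
  ∀Subset? P? with anySubset? (¬? ∘ P?)
  ... | yes (K , ¬PK) = no (λ ∀P → ¬PK (∀P K))
  ... | no ∄¬P        = yes (λ K → decidable-stable (P? K) (λ ¬PK → ∄¬P (K , ¬PK)))

  module SGBProperties {n : ℕ} (_∙_ : Op₂ (Fin n)) (ε : Fin n) (_⁻¹ : Op₁ (Fin n)) where

    open SGB _∙_ ε _⁻¹

    private
      Subgroup : Subset n → Set
      Subgroup = IsSubgroup _∙_ ε _⁻¹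

      _GeneratedBy_,_ : Subset n → Fin n → Fin n → Set
      _GeneratedBy_,_ = IsGeneratedBy _∙_ ε _⁻¹

    ∈-subgroups : ∀ {H} → Subgroup H → H ∈ₗ subgroups
    ∈-subgroups H≤G = ∈-filter⁺ (isSubgroup? _∙_ ε _⁻¹) (allSubsets-complete _) H≤G

    subgroups-unique : Unique subgroups
    subgroups-unique = filter⁺ (isSubgroup? _∙_ ε _⁻¹) (allSubsets-unique n)

    InEverySubgroupContaining : Fin n → Fin n → Pred (Fin n) 0ℓ
    InEverySubgroupContaining a b x = ∀ K → Subgroup K → a ∈ K → b ∈ K → x ∈ K

    inEverySubgroupContaining? : ∀ a b → Decidable (InEverySubgroupContaining a b)
    inEverySubgroupContaining? a b x =
      ∀Subset? (λ K → isSubgroup? _∙_ ε _⁻¹ K →-dec (a ∈? K) →-dec (b ∈? K) →-dec (x ∈? K))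

    ⟨_,_⟩ : Fin n → Fin n → Subset n
    ⟨ a , b ⟩ = subsetOf (inEverySubgroupContaining? a b)

    ⟨,⟩-generatedBy : ∀ a b → ⟨ a , b ⟩ GeneratedBy a , b
    ⟨,⟩-generatedBy a b = (ε∈ , ∙∈ , ⁻¹∈) , ∈⁺ (λ _ _ a∈K _ → a∈K) , ∈⁺ (λ _ _ _ b∈K → b∈K) , least
      where
      ∈⁺ : ∀ {x} → InEverySubgroupContaining a b x → x ∈ ⟨ a , b ⟩
      ∈⁺ = ∈-subsetOf⁺ (inEverySubgroupContaining? a b)
      ∈⁻ : ∀ {x} → x ∈ ⟨ a , b ⟩ → InEverySubgroupContaining a b x
      ∈⁻ = ∈-subsetOf⁻ (inEverySubgroupContaining? a b)
      ε∈ : ε ∈ ⟨ a , b ⟩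
      ε∈ = ∈⁺ (λ K (ε∈K , _) _ _ → ε∈K)
      ∙∈ : ∀ x y → x ∈ ⟨ a , b ⟩ → y ∈ ⟨ a , b ⟩ → x ∙ y ∈ ⟨ a , b ⟩
      ∙∈ x y x∈ y∈ = ∈⁺ (λ K K≤G@(_ , ∙∈K , _) a∈K b∈K → ∙∈K x y (∈⁻ x∈ K K≤G a∈K b∈K) (∈⁻ y∈ K K≤G a∈K b∈K))
      ⁻¹∈ : ∀ x → x ∈ ⟨ a , b ⟩ → x ⁻¹ ∈ ⟨ a , b ⟩
      ⁻¹∈ x x∈ = ∈⁺ (λ K K≤G@(_ , _ , ⁻¹∈K) a∈K b∈K → ⁻¹∈K x (∈⁻ x∈ K K≤G a∈K b∈K))
      least : ∀ K → Subgroup K → a ∈ K → b ∈ K → ⟨ a , b ⟩ ⊆ K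
      least K K≤G a∈K b∈K x∈ = ∈⁻ x∈ K K≤G a∈K b∈K

    generatedBy-unique : ∀ {H H′ a b} → H GeneratedBy a , b → H′ GeneratedBy a , b → H ≡ H′
    generatedBy-unique (H≤G , a∈H , b∈H , H-least) (H′≤G , a∈H′ , b∈H′ , H′-least) =
      ⊆-antisym (H-least _ H′≤G a∈H′ b∈H′) (H′-least _ H≤G a∈H b∈H)

    pair-degree≡1 : ∀ ab → degree (inj₁ ab) ≡ 1
    pair-degree≡1 (a , b) = count-unique (adjacent? (a , b)) subgroups-unique
      (∈-subgroups (proj₁ (⟨,⟩-generatedBy a b))) (⟨,⟩-generatedBy a b)
      (λ H-gen → generatedBy-unique H-gen (⟨,⟩-generatedBy a b))

    length-pairs : length pairs ≡ n * n
    length-pairs = trans (length-cartesianProduct (allFin n) (allFin n))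
                         (cong₂ _*_ (length-tabulate {n = n} id) (length-tabulate {n = n} id))

    degreeSquareSum : ℕ
    degreeSquareSum = sum (map (λ H → degree (inj₂ H) ^ 2) subgroups)

    M₂≡degreeSquareSum : M₂ ≡ degreeSquareSum
    M₂≡degreeSquareSum = begin
      M₂
        ≡⟨ sum-map-cong (λ (ab , H) → trans (cong (_* degree (inj₂ H)) (pair-degree≡1 ab)) (*-identityˡ _)) edges ⟩
      sum (map ((λ H → degree (inj₂ H)) ∘ proj₂) edges)
        ≡⟨ sum-filter-cartesianProduct-byColumns (λ (ab , H) → adjacent? ab H) (λ H → degree (inj₂ H)) pairs subgroups ⟩
      sum (map (λ H → degree (inj₂ H) * degree (inj₂ H)) subgroups)
        ≡⟨ sum-map-cong (λ H → cong (degree (inj₂ H) *_) (sym (*-identityʳ _))) subgroups ⟩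
      degreeSquareSum ∎
      where open ≡-Reasoning

    M₁≡n²+degreeSquareSum : M₁ ≡ n * n + degreeSquareSum
    M₁≡n²+degreeSquareSum = begin
      sum (map (λ v → degree v ^ 2) (map inj₁ pairs ++ map inj₂ subgroups))
        ≡⟨ cong sum (map-++ (λ v → degree v ^ 2) (map inj₁ pairs) (map inj₂ subgroups)) ⟩
      sum (map (λ v → degree v ^ 2) (map inj₁ pairs) ++ map (λ v → degree v ^ 2) (map inj₂ subgroups))
        ≡⟨ sum-++ (map (λ v → degree v ^ 2) (map inj₁ pairs)) _ ⟩
      sum (map (λ v → degree v ^ 2) (map inj₁ pairs)) + sum (map (λ v → degree v ^ 2) (map inj₂ subgroups))
        ≡⟨ cong₂ _+_ (cong sum (map-∘ pairs)) (cong sum (map-∘ subgroups)) ⟨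
      sum (map (λ ab → degree (inj₁ ab) ^ 2) pairs) + degreeSquareSum
        ≡⟨ cong (_+ degreeSquareSum) (trans (sum-map-one (λ ab → cong (_^ 2) (pair-degree≡1 ab)) pairs) length-pairs) ⟩
      n * n + degreeSquareSum ∎
      where open ≡-Reasoning

    numEdges≡n² : numEdges ≡ n * n
    numEdges≡n² = begin
      count (λ (ab , H) → adjacent? ab H) (cartesianProduct pairs subgroups)
        ≡⟨ count-cartesianProduct-byRows (λ (ab , H) → adjacent? ab H) pairs subgroups ⟩
      sum (map (λ ab → degree (inj₁ ab)) pairs)
        ≡⟨ sum-map-one pair-degree≡1 pairs ⟩
      length pairs
        ≡⟨ length-pairs ⟩
      n * n ∎
      where open ≡-Reasoning

    numVertices≡n²+|subgroups| : numVertices ≡ n * n + length subgroups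
    numVertices≡n²+|subgroups| = begin
      length (map inj₁ pairs ++ map inj₂ subgroups)          ≡⟨ length-++ (map inj₁ pairs) ⟩
      length (map inj₁ pairs) + length (map inj₂ subgroups)  ≡⟨ cong₂ _+_ (trans (length-map inj₁ pairs) length-pairs)
                                                                         (length-map inj₂ subgroups) ⟩
      n * n + length subgroups                               ∎
      where open ≡-Reasoning

module CyclicGroups where

  open import Defs
  open Counting using (count; count-image)
  open GeneratedSubgroups using (subsetOf; ∈-subsetOf⁺; ∈-subsetOf⁻)
  open import Level using (0ℓ)
  open import Data.Nat using (ℕ; zero; suc; _+_; _*_; _∸_; _≤_; _<_; z≤n; s≤s; s≤s⁻¹; NonZero; >-nonZero; >-nonZero⁻¹; _%_; _/_)
  open import Data.Nat.Properties
  open import Data.Nat.DivMod using (m≡m%n+[m/n]*n; m%n<n; m<n⇒m%n≡m)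
  open import Data.Nat.Divisibility
  open import Data.Fin using (Fin; toℕ; fromℕ<)
  open import Data.Fin.Properties using (nonZeroIndex; toℕ-injective; toℕ<n; toℕ-fromℕ<; pigeonhole; injective⇒≤)
  open import Data.Fin.Subset using (Subset; _∈_; _⊆_)
  open import Data.Fin.Subset.Properties using (_∈?_; ⊆-antisym; ⊆-reflexive)
  open import Data.List using (allFin)
  open import Data.Product using (_×_; _,_; proj₁; proj₂; ∃)
  open import Data.Sum using (_⊎_; inj₁; inj₂; [_,_]′)
  open import Function.Base using (id)
  open import Function.Bundles using (mk⇔)
  open import Relation.Nullary using (¬_; yes; no; _×-dec_; contradiction)
  open import Relation.Unary using (Pred; Decidable)
  open import Relation.Binary.PropositionalEquality
  open import Relation.Binary.Definitions using (tri<; tri≈; tri>)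
  open import Algebra.Core using (Op₁; Op₂)
  open import Algebra.Bundles using (Group)
  open import Algebra.Structures using (IsGroup)
  import Algebra.Properties.Group as GroupProperties

  least-witness : {P : Pred ℕ 0ℓ} → Decidable P → ∀ {m} → P m → ∃ λ k → P k × (∀ {j} → j < k → ¬ P j)
  least-witness {P} P? {m} Pm = [ (λ none → contradiction Pm (none (n<1+n m))) , id ]′ (search (suc m))
    where
    search : ∀ b → (∀ {j} → j < b → ¬ P j) ⊎ ∃ λ k → P k × (∀ {j} → j < k → ¬ P j)
    search zero = inj₁ (λ ())
    search (suc b) with search b | P? b
    ... | inj₂ found | _      = inj₂ found
    ... | inj₁ none  | yes Pb = inj₂ (b , Pb , none)
    ... | inj₁ none  | no ¬Pb = inj₁ (λ j<1+b → [ none , (λ { refl → ¬Pb }) ]′ (m<1+n⇒m<n∨m≡n j<1+b))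

  module CyclicGroup {n : ℕ} (_∙_ : Op₂ (Fin n)) (ε : Fin n) (_⁻¹ : Op₁ (Fin n))
                     (isGroup : IsGroup _≡_ _∙_ ε _⁻¹) (cyclic : IsCyclic _∙_ ε _⁻¹) where

    open IsGroup isGroup using (assoc; identityˡ; identityʳ; inverseʳ)

    private
      group : Group 0ℓ 0ℓ
      group = record { isGroup = isGroup }

    open GroupProperties group using (∙-cancelʳ; inverseˡ-unique)

    instance
      n-nonZero : NonZero n
      n-nonZero = nonZeroIndex ε

    private
      Subgroup : Subset n → Set
      Subgroup = IsSubgroup _∙_ ε _⁻¹

      g : Fin n
      g = proj₁ cyclic

    infix 30 g^_
    g^_ : ℕ → Fin n
    g^ k = pow _∙_ ε _⁻¹ g k

    exponent : Fin n → ℕ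
    exponent x = proj₁ (proj₂ cyclic x)

    g^exponent : ∀ x → g^ exponent x ≡ x
    g^exponent x = sym (proj₂ (proj₂ cyclic x))

    g^-+ : ∀ i j → g^ (i + j) ≡ g^ i ∙ g^ j
    g^-+ zero    j = sym (identityˡ (g^ j))
    g^-+ (suc i) j = trans (cong (g ∙_) (g^-+ i j)) (sym (assoc g (g^ i) (g^ j)))

    g^-period : ∀ {i j} → i ≤ j → g^ i ≡ g^ j → g^ (j ∸ i) ≡ ε
    g^-period {i} {j} i≤j g^i≡g^j = ∙-cancelʳ (g^ i) (g^ (j ∸ i)) ε (begin
      g^ (j ∸ i) ∙ g^ i   ≡⟨ g^-+ (j ∸ i) i ⟨
      g^ (j ∸ i + i)      ≡⟨ cong g^_ (m∸n+n≡m i≤j) ⟩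
      g^ j                ≡⟨ g^i≡g^j ⟨
      g^ i                ≡⟨ identityˡ (g^ i) ⟨
      ε ∙ g^ i            ∎)
      where open ≡-Reasoning

    g^-* : ∀ {t} → g^ t ≡ ε → ∀ q → g^ (q * t) ≡ ε
    g^-* g^t≡ε zero    = refl
    g^-* {t} g^t≡ε (suc q) = trans (g^-+ t (q * t)) (trans (cong₂ _∙_ g^t≡ε (g^-* g^t≡ε q)) (identityˡ ε))

    g^-% : ∀ {t} .{{_ : NonZero t}} → g^ t ≡ ε → ∀ k → g^ (k % t) ≡ g^ k
    g^-% {t} g^t≡ε k = sym (begin
      g^ k                              ≡⟨ cong g^_ (m≡m%n+[m/n]*n k t) ⟩
      g^ (k % t + (k / t) * t)          ≡⟨ g^-+ (k % t) ((k / t) * t) ⟩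
      g^ (k % t) ∙ g^ ((k / t) * t)     ≡⟨ cong (g^ (k % t) ∙_) (g^-* g^t≡ε (k / t)) ⟩
      g^ (k % t) ∙ ε                    ≡⟨ identityʳ _ ⟩
      g^ (k % t)                        ∎)
      where open ≡-Reasoning

    -- Every x is g^ (exponent x % t), so x ↦ exponent x % t injects G into Fin t.
    period≥n : ∀ {t} → 0 < t → g^ t ≡ ε → n ≤ t
    period≥n {t@(suc _)} _ g^t≡ε = injective⇒≤ {f = residue} residue-injective
      where
      residue : Fin n → Fin t
      residue x = fromℕ< (m%n<n (exponent x) t)
      g^residue : ∀ x → g^ toℕ (residue x) ≡ x
      g^residue x = trans (cong g^_ (toℕ-fromℕ< (m%n<n (exponent x) t))) (trans (g^-% {t} g^t≡ε (exponent x)) (g^exponent x))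
      residue-injective : ∀ {x y} → residue x ≡ residue y → x ≡ y
      residue-injective {x} {y} eq = trans (sym (g^residue x)) (trans (cong (λ i → g^ toℕ i) eq) (g^residue y))

    g^n≡ε : g^ n ≡ ε
    g^n≡ε with pigeonhole (n<1+n n) (λ (i : Fin (suc n)) → g^ toℕ i)
    ... | i , j , i<j , g^i≡g^j =
      subst (λ t → g^ t ≡ ε) (≤-antisym t≤n (period≥n (m<n⇒0<n∸m i<j) g^t≡ε)) g^t≡ε
      where
      g^t≡ε : g^ (toℕ j ∸ toℕ i) ≡ ε
      g^t≡ε = g^-period (<⇒≤ i<j) g^i≡g^j
      t≤n : toℕ j ∸ toℕ i ≤ n
      t≤n = ≤-trans (m∸n≤m (toℕ j) (toℕ i)) (s≤s⁻¹ (toℕ<n j))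

    g^-no-shorter-period : ∀ {i j} → i < j → j < n → g^ (j ∸ i) ≢ ε
    g^-no-shorter-period {i} {j} i<j j<n g^j-i≡ε =
      <⇒≱ (≤-<-trans (m∸n≤m j i) j<n) (period≥n (m<n⇒0<n∸m i<j) g^j-i≡ε)

    g^-injective : ∀ {i j} → i < n → j < n → g^ i ≡ g^ j → i ≡ j
    g^-injective {i} {j} i<n j<n g^i≡g^j with <-cmp i j
    ... | tri< i<j _ _ = contradiction (g^-period (<⇒≤ i<j) g^i≡g^j) (g^-no-shorter-period i<j j<n)
    ... | tri≈ _ i≡j _ = i≡j
    ... | tri> _ _ j<i = contradiction (g^-period (<⇒≤ j<i) (sym g^i≡g^j)) (g^-no-shorter-period j<i i<n)

    log : Fin n → ℕ
    log x = exponent x % n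

    log<n : ∀ x → log x < n
    log<n x = m%n<n (exponent x) n

    g^log : ∀ x → g^ log x ≡ x
    g^log x = trans (g^-% g^n≡ε (exponent x)) (g^exponent x)

    log-unique : ∀ {i x} → g^ i ≡ x → log x ≡ i % n
    log-unique {i} {x} g^i≡x =
      g^-injective (log<n x) (m%n<n i n) (trans (g^log x) (trans (sym g^i≡x) (sym (g^-% g^n≡ε i))))

    log-g^ : ∀ {i} → i < n → log (g^ i) ≡ i
    log-g^ i<n = trans (log-unique refl) (m<n⇒m%n≡m i<n)

    log-ε : log ε ≡ 0
    log-ε = log-g^ (>-nonZero⁻¹ n)

    log-∙ : ∀ x y → log (x ∙ y) ≡ (log x + log y) % n
    log-∙ x y = log-unique (trans (g^-+ (log x) (log y)) (cong₂ _∙_ (g^log x) (g^log y)))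

    log-⁻¹ : ∀ x → log (x ⁻¹) ≡ (n ∸ log x) % n
    log-⁻¹ x = log-unique (inverseˡ-unique (g^ (n ∸ log x)) x (begin
      g^ (n ∸ log x) ∙ x             ≡⟨ cong (g^ (n ∸ log x) ∙_) (g^log x) ⟨
      g^ (n ∸ log x) ∙ g^ log x      ≡⟨ g^-+ (n ∸ log x) (log x) ⟨
      g^ (n ∸ log x + log x)         ≡⟨ cong g^_ (m∸n+n≡m (<⇒≤ (log<n x))) ⟩
      g^ n                           ≡⟨ g^n≡ε ⟩
      ε                              ∎))
      where open ≡-Reasoning

    -- For d ∣ n this is the unique subgroup of index d.
    H : ℕ → Subset n
    H d = subsetOf (λ x → d ∣? log x)

    ∈H⁺ : ∀ {d x} → d ∣ log x → x ∈ H d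
    ∈H⁺ {d} = ∈-subsetOf⁺ (λ x → d ∣? log x)

    ∈H⁻ : ∀ {d x} → x ∈ H d → d ∣ log x
    ∈H⁻ {d} = ∈-subsetOf⁻ (λ x → d ∣? log x)

    H-isSubgroup : ∀ {d} → d ∣ n → Subgroup (H d)
    H-isSubgroup {d} d∣n = ε∈ , ∙∈ , ⁻¹∈
      where
      ε∈ : ε ∈ H d
      ε∈ = ∈H⁺ (subst (d ∣_) (sym log-ε) (d ∣0))
      ∙∈ : ∀ x y → x ∈ H d → y ∈ H d → x ∙ y ∈ H d
      ∙∈ x y x∈ y∈ = ∈H⁺ (subst (d ∣_) (sym (log-∙ x y)) (%-presˡ-∣ (∣m∣n⇒∣m+n (∈H⁻ x∈) (∈H⁻ y∈)) d∣n))
      ⁻¹∈ : ∀ x → x ∈ H d → x ⁻¹ ∈ H d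
      ⁻¹∈ x x∈ = ∈H⁺ (subst (d ∣_) (sym (log-⁻¹ x)) (%-presˡ-∣ (∣m+n∣m⇒∣n
                   (subst (d ∣_) (sym (m+[n∸m]≡n (<⇒≤ (log<n x)))) d∣n) (∈H⁻ x∈)) d∣n))

    g^∈H : ∀ {d i} → d ∣ n → d ∣ i → g^ i ∈ H d
    g^∈H d∣n d∣i = ∈H⁺ (subst (_ ∣_) (sym (log-unique refl)) (%-presˡ-∣ d∣i d∣n))

    g^∈H⇒∣ : ∀ {d i} → d ∣ n → g^ i ∈ H d → d ∣ i
    g^∈H⇒∣ d∣n g^i∈ = ∣n∣m%n⇒∣m d∣n (subst (_ ∣_) (log-unique refl) (∈H⁻ g^i∈))

    H-⊆⇒∣ : ∀ {d e} → d ∣ n → e ∣ n → H d ⊆ H e → e ∣ d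
    H-⊆⇒∣ d∣n e∣n Hd⊆He = g^∈H⇒∣ e∣n (Hd⊆He (g^∈H d∣n ∣-refl))

    H-injective : ∀ {d e} → d ∣ n → e ∣ n → H d ≡ H e → d ≡ e
    H-injective d∣n e∣n Hd≡He = ∣-antisym (H-⊆⇒∣ e∣n d∣n (⊆-reflexive (sym Hd≡He))) (H-⊆⇒∣ d∣n e∣n (⊆-reflexive Hd≡He))

    ∙∈-cancelʳ : ∀ {K x y} → Subgroup K → x ∙ y ∈ K → y ∈ K → x ∈ K
    ∙∈-cancelʳ {K} {x} {y} (_ , ∙∈K , ⁻¹∈K) xy∈K y∈K = subst (_∈ K) x∙y∙y⁻¹≡x (∙∈K _ _ xy∈K (⁻¹∈K y y∈K))
      where
      x∙y∙y⁻¹≡x : (x ∙ y) ∙ (y ⁻¹) ≡ x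
      x∙y∙y⁻¹≡x = trans (assoc x y (y ⁻¹)) (trans (cong (x ∙_) (inverseʳ y)) (identityʳ x))

    module _ {K : Subset n} (K≤G : Subgroup K) {k : ℕ} (0<k : 0 < k) (g^k∈K : g^ k ∈ K)
             (k-least : ∀ {j} → j < k → ¬ (0 < j × g^ j ∈ K)) where

      private
        instance
          k-nonZero : NonZero k
          k-nonZero = >-nonZero 0<k

      g^[q*k]∈K : ∀ q → g^ (q * k) ∈ K
      g^[q*k]∈K zero    = proj₁ K≤G
      g^[q*k]∈K (suc q) = subst (_∈ K) (sym (g^-+ k (q * k))) (proj₁ (proj₂ K≤G) _ _ g^k∈K (g^[q*k]∈K q))

      g^∈K⇒∣ : ∀ {i} → g^ i ∈ K → k ∣ i
      g^∈K⇒∣ {i} g^i∈K = m%n≡0⇒n∣m i k (remainder≡0 (i % k) refl)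
        where
        g^[i%k]∈K : g^ (i % k) ∈ K
        g^[i%k]∈K = ∙∈-cancelʳ K≤G (subst (_∈ K) (trans (cong g^_ (m≡m%n+[m/n]*n i k)) (g^-+ (i % k) _)) g^i∈K)
                                   (g^[q*k]∈K (i / k))
        remainder≡0 : ∀ r → r ≡ i % k → r ≡ 0
        remainder≡0 zero    _  = refl
        remainder≡0 (suc r) eq = contradiction (s≤s z≤n , subst (λ j → g^ j ∈ K) (sym eq) g^[i%k]∈K)
                                               (k-least (subst (_< k) (sym eq) (m%n<n i k)))

      K≡H : K ≡ H k
      K≡H = ⊆-antisym (λ {x} x∈K → ∈H⁺ (g^∈K⇒∣ (subst (_∈ K) (sym (g^log x)) x∈K))) Hk⊆K
        where
        Hk⊆K : H k ⊆ K
        Hk⊆K {x} x∈Hk with ∈H⁻ x∈Hk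
        ... | divides q log≡q*k = subst (_∈ K) (trans (cong g^_ (sym log≡q*k)) (g^log x)) (g^[q*k]∈K q)

    -- The witness is the least positive k with g^ k ∈ K.
    subgroup≡H : ∀ {K} → Subgroup K → ∃ λ k → k ∣ n × K ≡ H k
    subgroup≡H {K} K≤G =
      let g^n∈K : g^ n ∈ K
          g^n∈K = subst (_∈ K) (sym g^n≡ε) (proj₁ K≤G)
          (k , (0<k , g^k∈K) , k-least) = least-witness (λ i → (0 <? i) ×-dec (g^ i ∈? K)) (>-nonZero⁻¹ n , g^n∈K)
      in k , g^∈K⇒∣ K≤G 0<k g^k∈K k-least g^n∈K , K≡H K≤G 0<k g^k∈K k-least

    count-H : ∀ {d m} → d * m ≡ n → count (λ x → d ∣? log x) (allFin n) ≡ m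
    count-H {d} {m} d*m≡n = count-image (λ x → d ∣? log x) f f-injective (mk⇔ to from)
      where
      instance
        d-nonZero : NonZero d
        d-nonZero = m*n≢0⇒m≢0 d ⦃ subst NonZero (sym d*m≡n) n-nonZero ⦄
      f : Fin m → Fin n
      f j = g^ (d * toℕ j)
      d*j<n : ∀ j → d * toℕ j < n
      d*j<n j = subst (d * toℕ j <_) d*m≡n (*-monoʳ-< d (toℕ<n j))
      f-injective : ∀ {i j} → f i ≡ f j → i ≡ j
      f-injective {i} {j} fi≡fj = toℕ-injective (*-cancelˡ-≡ (toℕ i) (toℕ j) d (g^-injective (d*j<n i) (d*j<n j) fi≡fj))
      to : ∀ {z} → d ∣ log z → ∃ λ j → f j ≡ z
      to {z} (divides q log≡q*d) = fromℕ< q<m , (begin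
        g^ (d * toℕ (fromℕ< q<m)) ≡⟨ cong (λ i → g^ (d * i)) (toℕ-fromℕ< q<m) ⟩
        g^ (d * q)                ≡⟨ cong g^_ (trans (*-comm d q) (sym log≡q*d)) ⟩
        g^ log z                  ≡⟨ g^log z ⟩
        z                         ∎)
        where
        open ≡-Reasoning
        q<m : q < m
        q<m = *-cancelʳ-< _ q m (subst₂ _<_ log≡q*d (trans (sym d*m≡n) (*-comm d m)) (log<n z))
      from : ∀ {z} → (∃ λ j → f j ≡ z) → d ∣ log z
      from (j , refl) = divides (toℕ j) (trans (log-g^ (d*j<n j)) (*-comm d (toℕ j)))

module PrimePowers where

  open import Data.Nat using (ℕ; zero; suc; _+_; _*_; _∸_; _^_; _≤_; _<_; z≤n; s≤s; NonZero; nonTrivial⇒n>1)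
  open import Data.Nat.Properties
  open import Data.Nat.Divisibility
  open import Data.Nat.Primality using (Prime; euclidsLemma; prime⇒irreducible; prime⇒nonZero; prime⇒nonTrivial)
  open import Data.Nat.Coprimality using (Coprime; coprime-divisor; coprime⇒gcd≡1)
  open import Data.Nat.LCM using (lcm; lcm-least; gcd*lcm)
  open import Data.Product using (_×_; _,_; ∃; ∃₂)
  open import Data.Sum using (_⊎_; inj₁; inj₂)
  open import Function.Base using (_∘_)
  open import Relation.Nullary using (¬_; yes; no; contradiction)
  open import Relation.Binary.PropositionalEquality

  coprime⇒*∣ : ∀ {m n i} → Coprime m n → m ∣ i → n ∣ i → m * n ∣ i
  coprime⇒*∣ {m} {n} m⊥n m∣i n∣i = subst (_∣ _) lcm≡m*n (lcm-least m∣i n∣i)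
    where
    lcm≡m*n : lcm m n ≡ m * n
    lcm≡m*n = trans (sym (*-identityˡ (lcm m n)))
                    (trans (cong (_* lcm m n) (sym (coprime⇒gcd≡1 m⊥n))) (gcd*lcm m n))

  ^-monoʳ-∣ : ∀ r {a b} → a ≤ b → r ^ a ∣ r ^ b
  ^-monoʳ-∣ r {a} {b} a≤b = divides (r ^ (b ∸ a)) (begin
    r ^ b               ≡⟨ cong (r ^_) (m+[n∸m]≡n a≤b) ⟨
    r ^ (a + (b ∸ a))   ≡⟨ ^-distribˡ-+-* r a (b ∸ a) ⟩
    r ^ a * r ^ (b ∸ a) ≡⟨ *-comm (r ^ a) (r ^ (b ∸ a)) ⟩
    r ^ (b ∸ a) * r ^ a ∎)
    where open ≡-Reasoning

  module _ {r : ℕ} (r-prime : Prime r) where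

    private
      instance
        r-nonZero : NonZero r
        r-nonZero = prime⇒nonZero r-prime

    prime∤⇒coprime : ∀ {d} → ¬ r ∣ d → Coprime d r
    prime∤⇒coprime r∤d (i∣d , i∣r) with prime⇒irreducible r-prime i∣r
    ... | inj₁ i≡1 = i≡1
    ... | inj₂ refl = contradiction i∣d r∤d

    ∣prime*⇒ : ∀ {d m} → d ∣ r * m → (∃ λ d′ → d ≡ r * d′ × d′ ∣ m) ⊎ d ∣ m
    ∣prime*⇒ {d} {m} d∣rm with r ∣? d
    ... | yes (divides d′ refl) = inj₁ (d′ , *-comm d′ r , *-cancelˡ-∣ r (subst (_∣ r * m) (*-comm d′ r) d∣rm))
    ... | no r∤d = inj₂ (coprime-divisor (prime∤⇒coprime r∤d) d∣rm)

    ∣prime^⇒≡prime^ : ∀ α {d} → d ∣ r ^ α → ∃ λ a → a ≤ α × d ≡ r ^ a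
    ∣prime^⇒≡prime^ zero    d∣1 = 0 , z≤n , ∣1⇒≡1 d∣1
    ∣prime^⇒≡prime^ (suc α) d∣r^1+α with ∣prime*⇒ d∣r^1+α
    ... | inj₁ (d′ , refl , d′∣r^α) = let (a , a≤α , d′≡r^a) = ∣prime^⇒≡prime^ α d′∣r^α
                                       in suc a , s≤s a≤α , cong (r *_) d′≡r^a
    ... | inj₂ d∣r^α = let (a , a≤α , d≡r^a) = ∣prime^⇒≡prime^ α d∣r^α in a , m≤n⇒m≤1+n a≤α , d≡r^a

    prime>1 : 1 < r
    prime>1 = nonTrivial⇒n>1 r ⦃ prime⇒nonTrivial r-prime ⦄

    prime^∣prime^⇒≤ : ∀ {a b} → r ^ a ∣ r ^ b → a ≤ b
    prime^∣prime^⇒≤ {a} {b} r^a∣r^b =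
      ≮⇒≥ (λ b<a → <⇒≱ (^-monoʳ-< r prime>1 b<a) (∣⇒≤ ⦃ m^n≢0 r b ⦄ r^a∣r^b))

    module _ {s : ℕ} (s-prime : Prime s) (r≢s : r ≢ s) where

      prime∤prime^ : ∀ b → ¬ r ∣ s ^ b
      prime∤prime^ zero    r∣1 = <⇒≢ prime>1 (sym (∣1⇒≡1 r∣1))
      prime∤prime^ (suc b) r∣s^1+b with euclidsLemma s (s ^ b) r-prime r∣s^1+b
      ... | inj₂ r∣s^b = prime∤prime^ b r∣s^b
      ... | inj₁ r∣s with prime⇒irreducible s-prime r∣s
      ...   | inj₁ r≡1 = <⇒≢ prime>1 (sym r≡1)
      ...   | inj₂ r≡s = r≢s r≡s

      coprime-prime^ : ∀ a b → Coprime (r ^ a) (s ^ b)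
      coprime-prime^ a b (i∣r^a , i∣s^b) with ∣prime^⇒≡prime^ a i∣r^a
      ... | zero  , _ , i≡1   = i≡1
      ... | suc _ , _ , refl = contradiction (∣-trans (m∣m*n _) i∣s^b) (prime∤prime^ b)

  module TwoPrimes {p q : ℕ} (p-prime : Prime p) (q-prime : Prime q) (p≢q : p ≢ q) where

    ∣p^α*q^β⇒ : ∀ α β {d} → d ∣ p ^ α * q ^ β → ∃₂ λ a b → a ≤ α × b ≤ β × d ≡ p ^ a * q ^ b
    ∣p^α*q^β⇒ zero β {d} d∣q^β with ∣prime^⇒≡prime^ q-prime β (subst (d ∣_) (*-identityˡ (q ^ β)) d∣q^β)
    ... | b , b≤β , d≡q^b = 0 , b , z≤n , b≤β , trans d≡q^b (sym (*-identityˡ (q ^ b)))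
    ∣p^α*q^β⇒ (suc α) β {d} d∣ with ∣prime*⇒ p-prime (subst (d ∣_) (*-assoc p (p ^ α) (q ^ β)) d∣)
    ... | inj₁ (d′ , refl , d′∣) =
      let (a , b , a≤α , b≤β , d′≡) = ∣p^α*q^β⇒ α β d′∣
      in suc a , b , s≤s a≤α , b≤β , trans (cong (p *_) d′≡) (sym (*-assoc p (p ^ a) (q ^ b)))
    ... | inj₂ d∣′ =
      let (a , b , a≤α , b≤β , d≡) = ∣p^α*q^β⇒ α β d∣′
      in a , b , m≤n⇒m≤1+n a≤α , b≤β , d≡

    p^a*q^b∣⇒≤ : ∀ {a b a′ b′} → p ^ a * q ^ b ∣ p ^ a′ * q ^ b′ → a ≤ a′ × b ≤ b′
    p^a*q^b∣⇒≤ {a} {b} {a′} {b′} D∣D′ =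
      prime^∣prime^⇒≤ p-prime (coprime-divisor (coprime-prime^ p-prime q-prime p≢q a b′)
        (subst (p ^ a ∣_) (*-comm (p ^ a′) (q ^ b′)) (∣-trans (m∣m*n (q ^ b)) D∣D′))) ,
      prime^∣prime^⇒≤ q-prime (coprime-divisor (coprime-prime^ q-prime p-prime (p≢q ∘ sym) b a′)
        (∣-trans (n∣m*n (p ^ a)) D∣D′))

module OrderTwoPrimePowers where

  open import Defs
  open Counting
  open GeneratedSubgroups
  open CyclicGroups
  open PrimePowers
  open import Level using (0ℓ)
  open import Data.Nat using (ℕ; suc; _+_; _*_; _∸_; _^_; _≤_; _⊔_; z≤n; s≤s; NonZero; _≤?_)
  open import Data.Nat.Properties
  open import Data.Nat.Divisibility
  open import Data.Nat.Primality using (Prime; prime⇒nonZero)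
  open import Data.Nat.Tactic.RingSolver using (solve-∀)
  open import Data.Nat.Solver using (module +-*-Solver)
  open +-*-Solver using (solve; _:*_; _:^_; _:=_)
  open import Data.Nat.ListAction using (sum)
  open import Data.Nat.ListAction.Properties using (sum-↭)
  open import Data.Fin using (Fin; toℕ; fromℕ<)
  open import Data.Fin.Properties using (toℕ<n; toℕ-injective; toℕ-fromℕ<)
  open import Data.Fin.Subset using (Subset; _∈_; _⊆_)
  open import Data.List using (List; map; length; allFin; cartesianProduct)
  open import Data.List.Properties using (length-map; length-tabulate; map-∘)
  open import Data.List.Membership.Propositional using () renaming (_∈_ to _∈ₗ_)
  open import Data.List.Membership.Propositional.Properties using (∈-filter⁻; ∈-map⁺; ∈-map⁻; ∈-allFin; ∈-cartesianProduct⁺)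
  open import Data.List.Membership.Propositional.Properties.WithK using (unique∧set⇒bag)
  import Data.List.Relation.Unary.Unique.Propositional.Properties as Unique
  open import Data.List.Relation.Binary.Permutation.Propositional using (_↭_)
  import Data.List.Relation.Binary.Permutation.Propositional.Properties as Perm
  open import Data.List.Relation.Binary.BagAndSetEquality using (∼bag⇒↭)
  open import Data.Product using (_×_; _,_; proj₁; proj₂; ∃₂)
  open import Data.Sum using (inj₁; inj₂)
  open import Function.Base using (id)
  open import Function.Bundles using (mk⇔)
  open import Relation.Nullary using (¬_; yes; no; _×-dec_; ¬?; contradiction)
  open import Relation.Unary using (Pred; Decidable)
  open import Relation.Binary.PropositionalEquality
  open import Algebra.Core using (Op₁; Op₂)
  open import Algebra.Structures using (IsGroup)

  -- r ^ (γ ∸ a) is the r-part of the order of H (p ^ a * q ^ b) in the cyclic group of order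
  -- p ^ α * q ^ β (with r , γ = p , α or q , β); it is 0 for a > γ, where there is no such subgroup.
  cofactor : ℕ → ℕ → ℕ → ℕ
  cofactor r γ a with a ≤? γ
  ... | yes _ = r ^ (γ ∸ a)
  ... | no _  = 0

  cofactor-suc≤ : ∀ r .{{_ : NonZero r}} γ a → cofactor r γ (suc a) ≤ cofactor r γ a
  cofactor-suc≤ r γ a with suc a ≤? γ | a ≤? γ
  ... | yes _     | yes _   = ^-monoʳ-≤ r (∸-monoʳ-≤ γ (n≤1+n a))
  ... | yes 1+a≤γ | no a≰γ  = contradiction (≤-trans (n≤1+n a) 1+a≤γ) a≰γ
  ... | no _      | _       = z≤n

  -- For a ≤ γ this is the Jordan totient J₂ (r ^ (γ ∸ a)): the number of pairs generating a cyclic group of that order.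
  degreeFactor : ℕ → ℕ → ℕ → ℕ
  degreeFactor r γ a = cofactor r γ a * cofactor r γ a ∸ cofactor r γ (suc a) * cofactor r γ (suc a)

  -- Writing s * s = s′ * s′ + u and t * t = t′ * t′ + v, both sides differ exactly by u * v.
  inclusion-exclusion-product : ∀ {x s s′ t t′} → s′ ≤ s → t′ ≤ t →
    x + (s′ * t) * (s′ * t) + (s * t′) * (s * t′) ≡ (s * t) * (s * t) + (s′ * t′) * (s′ * t′) →
    x ≡ (s * s ∸ s′ * s′) * (t * t ∸ t′ * t′)
  inclusion-exclusion-product {x} {s} {s′} {t} {t′} s′≤s t′≤t eq = +-cancelʳ-≡ common x (u * v) (begin
    x + common                                        ≡⟨ expandˡ x s′ t′ u v ⟨
    x + (s′ * s′) * (t′ * t′ + v) + (s′ * s′ + u) * (t′ * t′)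
                                                      ≡⟨ cong₂ (λ S T → x + (s′ * s′) * T + S * (t′ * t′)) s² t² ⟩
    x + (s′ * s′) * (t * t) + (s * s) * (t′ * t′)     ≡⟨ cong₂ (λ A B → x + A + B) (square-* s′ t) (square-* s t′) ⟨
    x + (s′ * t) * (s′ * t) + (s * t′) * (s * t′)     ≡⟨ eq ⟩
    (s * t) * (s * t) + (s′ * t′) * (s′ * t′)         ≡⟨ cong₂ _+_ (square-* s t) (square-* s′ t′) ⟩
    (s * s) * (t * t) + (s′ * s′) * (t′ * t′)         ≡⟨ cong₂ (λ S T → S * T + (s′ * s′) * (t′ * t′)) s² t² ⟨
    (s′ * s′ + u) * (t′ * t′ + v) + (s′ * s′) * (t′ * t′)
                                                      ≡⟨ expandʳ s′ t′ u v ⟩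
    u * v + common                                    ∎)
    where
    open ≡-Reasoning
    u v : ℕ
    u = s * s ∸ s′ * s′
    v = t * t ∸ t′ * t′
    s² : s′ * s′ + u ≡ s * s
    s² = m+[n∸m]≡n (*-mono-≤ s′≤s s′≤s)
    t² : t′ * t′ + v ≡ t * t
    t² = m+[n∸m]≡n (*-mono-≤ t′≤t t′≤t)
    common : ℕ
    common = 2 * (s′ * s′) * (t′ * t′) + (s′ * s′) * v + u * (t′ * t′)
    square-* : ∀ a b → (a * b) * (a * b) ≡ (a * a) * (b * b)
    square-* = solve-∀
    expandˡ : ∀ x s′ t′ u v → x + (s′ * s′) * (t′ * t′ + v) + (s′ * s′ + u) * (t′ * t′)
                            ≡ x + (2 * (s′ * s′) * (t′ * t′) + (s′ * s′) * v + u * (t′ * t′))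
    expandˡ = solve-∀
    expandʳ : ∀ s′ t′ u v → (s′ * s′ + u) * (t′ * t′ + v) + (s′ * s′) * (t′ * t′)
                          ≡ u * v + (2 * (s′ * s′) * (t′ * t′) + (s′ * s′) * v + u * (t′ * t′))
    expandʳ = solve-∀

  module CyclicOfOrderP^αQ^β {p q : ℕ} (p-prime : Prime p) (q-prime : Prime q) (p≢q : p ≢ q) (α β : ℕ)
    (_∙_ : Op₂ (Fin (p ^ α * q ^ β))) (ε : Fin (p ^ α * q ^ β)) (_⁻¹ : Op₁ (Fin (p ^ α * q ^ β)))
    (isGroup : IsGroup _≡_ _∙_ ε _⁻¹) (cyclic : IsCyclic _∙_ ε _⁻¹) where

    open SGB _∙_ ε _⁻¹
    open SGBProperties _∙_ ε _⁻¹
    open CyclicGroup _∙_ ε _⁻¹ isGroup cyclic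
    open TwoPrimes p-prime q-prime p≢q

    private
      n : ℕ
      n = p ^ α * q ^ β

      instance
        p-nonZero : NonZero p
        p-nonZero = prime⇒nonZero p-prime
        q-nonZero : NonZero q
        q-nonZero = prime⇒nonZero q-prime

    D : ℕ → ℕ → ℕ
    D a b = p ^ a * q ^ b

    D-mono-∣ : ∀ {a b a′ b′} → a ≤ a′ → b ≤ b′ → D a b ∣ D a′ b′
    D-mono-∣ a≤a′ b≤b′ = *-pres-∣ (^-monoʳ-∣ p a≤a′) (^-monoʳ-∣ q b≤b′)

    D-⊔ : ∀ {a b a′ b′ i} → D a b ∣ i → D a′ b′ ∣ i → D (a ⊔ a′) (b ⊔ b′) ∣ i
    D-⊔ {a} {b} {a′} {b′} {i} Dab∣i Da′b′∣i =
      coprime⇒*∣ (coprime-prime^ p-prime q-prime p≢q (a ⊔ a′) (b ⊔ b′)) p^[a⊔a′]∣i q^[b⊔b′]∣i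
      where
      p^[a⊔a′]∣i : p ^ (a ⊔ a′) ∣ i
      p^[a⊔a′]∣i with ⊔-sel a a′
      ... | inj₁ eq = subst (λ c → p ^ c ∣ i) (sym eq) (∣-trans (m∣m*n (q ^ b)) Dab∣i)
      ... | inj₂ eq = subst (λ c → p ^ c ∣ i) (sym eq) (∣-trans (m∣m*n (q ^ b′)) Da′b′∣i)
      q^[b⊔b′]∣i : q ^ (b ⊔ b′) ∣ i
      q^[b⊔b′]∣i with ⊔-sel b b′
      ... | inj₁ eq = subst (λ c → q ^ c ∣ i) (sym eq) (∣-trans (n∣m*n (p ^ a)) Dab∣i)
      ... | inj₂ eq = subst (λ c → q ^ c ∣ i) (sym eq) (∣-trans (n∣m*n (p ^ a′)) Da′b′∣i)

    D*cofactors≡n : ∀ {a b} → a ≤ α → b ≤ β → D a b * (p ^ (α ∸ a) * q ^ (β ∸ b)) ≡ n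
    D*cofactors≡n {a} {b} a≤α b≤β = begin
      (p ^ a * q ^ b) * (p ^ (α ∸ a) * q ^ (β ∸ b)) ≡⟨ interchange (p ^ a) (q ^ b) _ _ ⟩
      (p ^ a * p ^ (α ∸ a)) * (q ^ b * q ^ (β ∸ b)) ≡⟨ cong₂ _*_ (^-distribˡ-+-* p a _) (^-distribˡ-+-* q b _) ⟨
      p ^ (a + (α ∸ a)) * q ^ (b + (β ∸ b))         ≡⟨ cong₂ (λ i j → p ^ i * q ^ j) (m+[n∸m]≡n a≤α) (m+[n∸m]≡n b≤β) ⟩
      p ^ α * q ^ β                                 ∎
      where
      open ≡-Reasoning
      interchange : ∀ w x y z → (w * x) * (y * z) ≡ (w * y) * (x * z)
      interchange = solve-∀

    D-injective : ∀ {a b a′ b′} → D a b ≡ D a′ b′ → a ≡ a′ × b ≡ b′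
    D-injective eq with p^a*q^b∣⇒≤ (∣-reflexive eq) | p^a*q^b∣⇒≤ (∣-reflexive (sym eq))
    ... | a≤a′ , b≤b′ | a′≤a , b′≤b = ≤-antisym a≤a′ a′≤a , ≤-antisym b≤b′ b′≤b

    D∣n : ∀ {a b} → a ≤ α → b ≤ β → D a b ∣ n
    D∣n {a} {b} a≤α b≤β = divides (p ^ (α ∸ a) * q ^ (β ∸ b)) (trans (sym (D*cofactors≡n a≤α b≤β)) (*-comm (D a b) _))

    subgroup≡H[D] : ∀ {K} → IsSubgroup _∙_ ε _⁻¹ K → ∃₂ λ a b → a ≤ α × b ≤ β × K ≡ H (D a b)
    subgroup≡H[D] K≤G =
      let (k , k∣n , K≡Hk) = subgroup≡H K≤G
          (a , b , a≤α , b≤β , k≡Dab) = ∣p^α*q^β⇒ α β k∣n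
      in a , b , a≤α , b≤β , trans K≡Hk (cong H k≡Dab)

    Within : ℕ → ℕ → Pred (Fin n) 0ℓ
    Within a b x = a ≤ α × b ≤ β × D a b ∣ log x

    within? : ∀ a b → Decidable (Within a b)
    within? a b x = (a ≤? α) ×-dec (b ≤? β) ×-dec (D a b ∣? log x)

    within-antitone : ∀ {a b a′ b′ x} → a ≤ a′ → b ≤ b′ → Within a′ b′ x → Within a b x
    within-antitone a≤a′ b≤b′ (a′≤α , b′≤β , D∣x) =
      ≤-trans a≤a′ a′≤α , ≤-trans b≤b′ b′≤β , ∣-trans (D-mono-∣ a≤a′ b≤b′) D∣x

    within-⊔ : ∀ {a b a′ b′ x} → Within a b x → Within a′ b′ x → Within (a ⊔ a′) (b ⊔ b′) x
    within-⊔ {a} {b} {a′} {b′} (a≤α , b≤β , D∣x) (a′≤α , b′≤β , D′∣x) =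
      ⊔-lub a≤α a′≤α , ⊔-lub b≤β b′≤β , D-⊔ {a} {b} {a′} {b′} D∣x D′∣x

    count-within : ∀ a b → count (within? a b) (allFin n) ≡ cofactor p α a * cofactor q β b
    count-within a b with a ≤? α | b ≤? β
    ... | yes a≤α | yes b≤β = trans (count-≐ _ (λ x → D a b ∣? log x)
                                        ((λ (_ , _ , D∣x) → D∣x) , (λ D∣x → a≤α , b≤β , D∣x)) (allFin n))
                                     (count-H (D*cofactors≡n a≤α b≤β))
    ... | yes _   | no b≰β  = trans (count-none _ (allFin n) (λ _ (_ , b≤β , _) → b≰β b≤β))
                                     (sym (*-zeroʳ (p ^ (α ∸ a))))
    ... | no a≰α  | _       = count-none _ (allFin n) (λ _ (a≤α , _) → a≰α a≤α)

    Both : ℕ → ℕ → Pred (Fin n × Fin n) 0ℓ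
    Both a b (x , y) = Within a b x × Within a b y

    both? : ∀ a b → Decidable (Both a b)
    both? a b (x , y) = within? a b x ×-dec within? a b y

    both-antitone : ∀ {a b a′ b′ xy} → a ≤ a′ → b ≤ b′ → Both a′ b′ xy → Both a b xy
    both-antitone a≤a′ b≤b′ (x-within , y-within) = within-antitone a≤a′ b≤b′ x-within , within-antitone a≤a′ b≤b′ y-within

    both-⊔ : ∀ {a b a′ b′ xy} → Both a b xy → Both a′ b′ xy → Both (a ⊔ a′) (b ⊔ b′) xy
    both-⊔ (x-within , y-within) (x-within′ , y-within′) = within-⊔ x-within x-within′ , within-⊔ y-within y-within′

    count-both : ∀ a b → count (both? a b) pairs ≡ (cofactor p α a * cofactor q β b) * (cofactor p α a * cofactor q β b)
    count-both a b = trans (count-cartesianProduct (within? a b) (within? a b) (allFin n) (allFin n))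
                           (cong₂ _*_ (count-within a b) (count-within a b))

    -- H (D (suc a) b) and H (D a (suc b)) are the maximal subgroups of H (D a b).
    Generates : ℕ → ℕ → Pred (Fin n × Fin n) 0ℓ
    Generates a b xy = Both a b xy × ¬ Both (suc a) b xy × ¬ Both a (suc b) xy

    generates? : ∀ a b → Decidable (Generates a b)
    generates? a b xy = both? a b xy ×-dec ¬? (both? (suc a) b xy) ×-dec ¬? (both? a (suc b) xy)

    generatedBy⇒generates : ∀ {a b x y} → a ≤ α → b ≤ β →
                            IsGeneratedBy _∙_ ε _⁻¹ (H (D a b)) x y → Generates a b (x , y)
    generatedBy⇒generates {a} {b} {x} {y} a≤α b≤β (_ , x∈H , y∈H , H-least) =
      ((a≤α , b≤β , ∈H⁻ x∈H) , (a≤α , b≤β , ∈H⁻ y∈H)) ,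
      (λ both → 1+n≰n (proj₁ (forced both))) , (λ both → 1+n≰n (proj₂ (forced both)))
      where
      forced : ∀ {a′ b′} → Both a′ b′ (x , y) → a′ ≤ a × b′ ≤ b
      forced {a′} {b′} ((a′≤α , b′≤β , x∣) , (_ , _ , y∣)) =
        p^a*q^b∣⇒≤ (H-⊆⇒∣ (D∣n a≤α b≤β) (D∣n a′≤α b′≤β)
          (H-least (H (D a′ b′)) (H-isSubgroup (D∣n a′≤α b′≤β)) (∈H⁺ x∣) (∈H⁺ y∣)))

    generates-maximal : ∀ {a b a′ b′ xy} → Generates a b xy → Both a′ b′ xy → a′ ≤ a × b′ ≤ b
    generates-maximal {a} {b} {a′} {b′} {xy} (both , ¬both₁ , ¬both₂) both′ =
      ≮⇒≥ (λ a<a′ → ¬both₁ (both-antitone (≤-trans a<a′ (m≤n⊔m a a′)) (m≤m⊔n b b′) joined)) ,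
      ≮⇒≥ (λ b<b′ → ¬both₂ (both-antitone (m≤m⊔n a a′) (≤-trans b<b′ (m≤n⊔m b b′)) joined))
      where
      joined : Both (a ⊔ a′) (b ⊔ b′) xy
      joined = both-⊔ both both′

    generates⇒generatedBy : ∀ {a b x y} → a ≤ α → b ≤ β →
                            Generates a b (x , y) → IsGeneratedBy _∙_ ε _⁻¹ (H (D a b)) x y
    generates⇒generatedBy {a} {b} {x} {y} a≤α b≤β gen@(((_ , _ , x∣) , (_ , _ , y∣)) , _) =
      H-isSubgroup (D∣n a≤α b≤β) , ∈H⁺ x∣ , ∈H⁺ y∣ , least
      where
      least : ∀ K → IsSubgroup _∙_ ε _⁻¹ K → x ∈ K → y ∈ K → H (D a b) ⊆ K
      least K K≤G x∈K y∈K {z} z∈H =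
        let (a′ , b′ , a′≤α , b′≤β , K≡H) = subgroup≡H[D] K≤G
            within : ∀ {w} → w ∈ K → Within a′ b′ w
            within {w} w∈K = a′≤α , b′≤β , ∈H⁻ (subst (w ∈_) K≡H w∈K)
            (a′≤a , b′≤b) = generates-maximal gen (within x∈K , within y∈K)
        in subst (z ∈_) (sym K≡H) (∈H⁺ (∣-trans (D-mono-∣ a′≤a b′≤b) (∈H⁻ z∈H)))

    degree-H : ∀ {a b} → a ≤ α → b ≤ β → degree (inj₂ (H (D a b))) ≡ degreeFactor p α a * degreeFactor q β b
    degree-H {a} {b} a≤α b≤β = inclusion-exclusion-product (cofactor-suc≤ p α a) (cofactor-suc≤ q β b) (begin
      degree (inj₂ (H (D a b))) + pairCount (suc a) b + pairCount a (suc b)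
        ≡⟨ cong₂ (λ c₁ c₂ → degree (inj₂ (H (D a b))) + c₁ + c₂) (count-both (suc a) b) (count-both a (suc b)) ⟨
      degree (inj₂ (H (D a b))) + count (both? (suc a) b) pairs + count (both? a (suc b)) pairs
        ≡⟨ cong (λ d → d + count (both? (suc a) b) pairs + count (both? a (suc b)) pairs) degree≡count-generates ⟩
      count (generates? a b) pairs + count (both? (suc a) b) pairs + count (both? a (suc b)) pairs
        ≡⟨ count-inclusion-exclusion (both? a b) (both? (suc a) b) (both? a (suc b))
             (both-antitone (n≤1+n a) ≤-refl) (both-antitone ≤-refl (n≤1+n b)) pairs ⟩
      count (both? a b) pairs + count (λ xy → both? (suc a) b xy ×-dec both? a (suc b) xy) pairs
        ≡⟨ cong (count (both? a b) pairs +_) (count-≐ _ (both? (suc a) (suc b)) (corner , corner⁻¹) pairs) ⟩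
      count (both? a b) pairs + count (both? (suc a) (suc b)) pairs
        ≡⟨ cong₂ _+_ (count-both a b) (count-both (suc a) (suc b)) ⟩
      pairCount a b + pairCount (suc a) (suc b) ∎)
      where
      open ≡-Reasoning
      pairCount : ℕ → ℕ → ℕ
      pairCount a b = (cofactor p α a * cofactor q β b) * (cofactor p α a * cofactor q β b)
      degree≡count-generates : degree (inj₂ (H (D a b))) ≡ count (generates? a b) pairs
      degree≡count-generates = count-≐ (λ xy → adjacent? xy (H (D a b))) (generates? a b)
        (generatedBy⇒generates a≤α b≤β , generates⇒generatedBy a≤α b≤β) pairs
      corner : ∀ {xy} → Both (suc a) b xy × Both a (suc b) xy → Both (suc a) (suc b) xy
      corner (both₁ , both₂) = both-antitone (m≤m⊔n (suc a) a) (m≤n⊔m b (suc b)) (both-⊔ both₁ both₂)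
      corner⁻¹ : ∀ {xy} → Both (suc a) (suc b) xy → Both (suc a) b xy × Both a (suc b) xy
      corner⁻¹ both = both-antitone ≤-refl (n≤1+n b) both , both-antitone (n≤1+n a) ≤-refl both

    exponentPairs : List (Fin (suc α) × Fin (suc β))
    exponentPairs = cartesianProduct (allFin (suc α)) (allFin (suc β))

    H[_] : Fin (suc α) × Fin (suc β) → Subset n
    H[ i , j ] = H (D (toℕ i) (toℕ j))

    H[]-injective : ∀ {u v} → H[ u ] ≡ H[ v ] → u ≡ v
    H[]-injective {i , j} {i′ , j′} eq =
      let (i≡i′ , j≡j′) = D-injective (H-injective (D∣n (bound i) (bound j)) (D∣n (bound i′) (bound j′)) eq)
      in cong₂ _,_ (toℕ-injective i≡i′) (toℕ-injective j≡j′)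
      where
      bound : ∀ {γ} (k : Fin (suc γ)) → toℕ k ≤ γ
      bound k = ≤-pred (toℕ<n k)

    subgroups↭ : subgroups ↭ map H[_] exponentPairs
    subgroups↭ = ∼bag⇒↭ (unique∧set⇒bag subgroups-unique
      (Unique.map⁺ H[]-injective (Unique.cartesianProduct⁺ (Unique.allFin⁺ (suc α)) (Unique.allFin⁺ (suc β))))
      (mk⇔ to from))
      where
      H[D]∈ : ∀ {a b} → a ≤ α → b ≤ β → H (D a b) ∈ₗ map H[_] exponentPairs
      H[D]∈ a≤α b≤β = subst (_∈ₗ map H[_] exponentPairs)
        (cong₂ (λ a b → H (D a b)) (toℕ-fromℕ< (s≤s a≤α)) (toℕ-fromℕ< (s≤s b≤β)))
        (∈-map⁺ H[_] (∈-cartesianProduct⁺ (∈-allFin (fromℕ< (s≤s a≤α))) (∈-allFin (fromℕ< (s≤s b≤β)))))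
      to : ∀ {K} → K ∈ₗ subgroups → K ∈ₗ map H[_] exponentPairs
      to K∈ = let (a , b , a≤α , b≤β , K≡H) = subgroup≡H[D] (proj₂ (∈-filter⁻ (isSubgroup? _∙_ ε _⁻¹) {xs = allSubsets n} K∈))
              in subst (_∈ₗ map H[_] exponentPairs) (sym K≡H) (H[D]∈ a≤α b≤β)
      from : ∀ {K} → K ∈ₗ map H[_] exponentPairs → K ∈ₗ subgroups
      from K∈ =
        let ((i , j) , _ , K≡H[i,j]) = ∈-map⁻ H[_] {xs = exponentPairs} K∈
        in subst (_∈ₗ subgroups) (sym K≡H[i,j]) (∈-subgroups (H-isSubgroup (D∣n (≤-pred (toℕ<n i)) (≤-pred (toℕ<n j)))))

    length-subgroups : length subgroups ≡ suc α * suc β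
    length-subgroups = begin
      length subgroups                      ≡⟨ Perm.↭-length subgroups↭ ⟩
      length (map H[_] exponentPairs)       ≡⟨ length-map H[_] exponentPairs ⟩
      length exponentPairs                  ≡⟨ length-cartesianProduct (allFin (suc α)) (allFin (suc β)) ⟩
      length (allFin (suc α)) * length (allFin (suc β))
                                            ≡⟨ cong₂ _*_ (length-tabulate {n = suc α} id) (length-tabulate {n = suc β} id) ⟩
      suc α * suc β                         ∎
      where open ≡-Reasoning

    degreeSquareSum≡product : degreeSquareSum ≡ sum (map (λ i → degreeFactor p α (toℕ i) ^ 2) (allFin (suc α)))
                                               * sum (map (λ j → degreeFactor q β (toℕ j) ^ 2) (allFin (suc β)))
    degreeSquareSum≡product = begin
      sum (map (λ K → degree (inj₂ K) ^ 2) subgroups)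
        ≡⟨ sum-↭ (Perm.map⁺ (λ K → degree (inj₂ K) ^ 2) subgroups↭) ⟩
      sum (map (λ K → degree (inj₂ K) ^ 2) (map H[_] exponentPairs))
        ≡⟨ cong sum (map-∘ exponentPairs) ⟨
      sum (map (λ u → degree (inj₂ H[ u ]) ^ 2) exponentPairs)
        ≡⟨ sum-map-cong (λ (i , j) → trans (cong (_^ 2) (degree-H (≤-pred (toℕ<n i)) (≤-pred (toℕ<n j))))
                                            (square-* (degreeFactor p α (toℕ i)) (degreeFactor q β (toℕ j)))) exponentPairs ⟩
      sum (map (λ (i , j) → degreeFactor p α (toℕ i) ^ 2 * degreeFactor q β (toℕ j) ^ 2) exponentPairs)
        ≡⟨ sum-map-cartesianProduct (λ i → degreeFactor p α (toℕ i) ^ 2) (λ j → degreeFactor q β (toℕ j) ^ 2)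
                                    (allFin (suc α)) (allFin (suc β)) ⟩
      sum (map (λ i → degreeFactor p α (toℕ i) ^ 2) (allFin (suc α)))
        * sum (map (λ j → degreeFactor q β (toℕ j) ^ 2) (allFin (suc β))) ∎
      where
      open ≡-Reasoning
      square-* : ∀ a b → (a * b) ^ 2 ≡ a ^ 2 * b ^ 2
      square-* = solve 2 (λ a b → (a :* b) :^ 2 := a :^ 2 :* b :^ 2) refl

module SquareSums where

  open OrderTwoPrimePowers using (degreeFactor)
  open import Data.Nat using (ℕ; suc; pred; _+_; _*_; _∸_; _^_; _≤_; _<_; z≤n; s≤s; NonZero)
  open import Data.Nat.Properties
  open import Data.Nat.ListAction using (sum)
  open import Data.Nat.Solver using (module +-*-Solver)
  open import Data.Nat.Tactic.RingSolver as ℕ-Solver using ()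
  open import Data.Integer as ℤ using (ℤ; +_; _-_)
  import Data.Integer.Properties as ℤ
  open import Data.Integer.Tactic.RingSolver as ℤ-Solver using ()
  open import Data.Fin using (toℕ)
  open import Data.List using (map; allFin)
  open import Relation.Binary.PropositionalEquality
  open +-*-Solver using (solve; _:+_; _:*_; _:^_; con; _:=_)

  degreeFactorSquareSum : ℕ → ℕ
  degreeFactorSquareSum r = sum (map (λ i → degreeFactor r 2 (toℕ i) ^ 2) (allFin 3))

  degreeFactorSquareSum≡ : ∀ r w → r ^ 2 ≡ suc w → degreeFactorSquareSum r ≡ (suc w * w) ^ 2 + (w ^ 2 + 1)
  degreeFactorSquareSum≡ r w r²≡1+w = cong₂ (λ d₀ d₁ → d₀ ^ 2 + (d₁ ^ 2 + 1)) d₀≡ (cong (_∸ 1) r¹*r¹≡1+w)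
    where
    r¹*r¹≡1+w : r ^ 1 * r ^ 1 ≡ suc w
    r¹*r¹≡1+w = trans (solve 1 (λ r → r :^ 1 :* r :^ 1 := r :^ 2) refl r) r²≡1+w
    d₀≡ : r ^ 2 * r ^ 2 ∸ r ^ 1 * r ^ 1 ≡ suc w * w
    d₀≡ = begin
      r ^ 2 * r ^ 2 ∸ r ^ 1 * r ^ 1  ≡⟨ cong₂ (λ x y → x * x ∸ y) r²≡1+w r¹*r¹≡1+w ⟩
      suc w * suc w ∸ suc w          ≡⟨ cong (_∸ suc w) (*-suc (suc w) w) ⟩
      suc w + suc w * w ∸ suc w      ≡⟨ m+n∸m≡n (suc w) (suc w * w) ⟩
      suc w * w                      ∎
      where open ≡-Reasoning

  degreeFactorSquareSum-identity : ∀ r .{{_ : NonZero r}} →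
    degreeFactorSquareSum r + 2 * r ^ 6 + 2 * r ^ 2 ≡ r ^ 8 + 2 * r ^ 4 + 2
  degreeFactorSquareSum-identity r = begin
    degreeFactorSquareSum r + 2 * r ^ 6 + 2 * r ^ 2
      ≡⟨ cong (λ x → degreeFactorSquareSum r + 2 * x + 2 * r ^ 2) (^-*-assoc r 2 3) ⟨
    degreeFactorSquareSum r + 2 * (r ^ 2) ^ 3 + 2 * r ^ 2
      ≡⟨ cong₂ (λ S X → S + 2 * X ^ 3 + 2 * X) (degreeFactorSquareSum≡ r w r²≡1+w) r²≡1+w ⟩
    ((suc w * w) ^ 2 + (w ^ 2 + 1)) + 2 * suc w ^ 3 + 2 * suc w
      ≡⟨ solve 1 (λ w → ((con 1 :+ w) :* w) :^ 2 :+ (w :^ 2 :+ con 1) :+ con 2 :* (con 1 :+ w) :^ 3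
                          :+ con 2 :* (con 1 :+ w)
                   := (con 1 :+ w) :^ 4 :+ con 2 :* (con 1 :+ w) :^ 2 :+ con 2) refl w ⟩
    suc w ^ 4 + 2 * suc w ^ 2 + 2
      ≡⟨ cong (λ X → X ^ 4 + 2 * X ^ 2 + 2) r²≡1+w ⟨
    (r ^ 2) ^ 4 + 2 * (r ^ 2) ^ 2 + 2
      ≡⟨ cong₂ (λ x y → x + 2 * y + 2) (^-*-assoc r 2 4) (^-*-assoc r 2 2) ⟩
    r ^ 8 + 2 * r ^ 4 + 2 ∎
    where
    open ≡-Reasoning
    w : ℕ
    w = pred (r ^ 2)
    r²≡1+w : r ^ 2 ≡ suc w
    r²≡1+w = sym (suc-pred (r ^ 2) ⦃ m^n≢0 r 2 ⦄)

  degreeFactorSquareSum-bound : ∀ r → 2 ≤ r → r ^ 8 < 3 * degreeFactorSquareSum r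
  degreeFactorSquareSum-bound r@(suc (suc _)) (s≤s (s≤s _)) = begin-strict
    r ^ 8
      ≡⟨ ^-*-assoc r 2 4 ⟨
    (r ^ 2) ^ 4
      ≡⟨ cong (_^ 4) r²≡2+t ⟩
    (2 + t) ^ 4
      <⟨ m<m+n ((2 + t) ^ 4) (s≤s z≤n) ⟩
    (2 + t) ^ 4 + (2 + 10 * t + 18 * t ^ 2 + 10 * t ^ 3 + 2 * t ^ 4)
      ≡⟨ solve 1 (λ t → (con 2 :+ t) :^ 4 :+ (con 2 :+ con 10 :* t :+ con 18 :* t :^ 2 :+ con 10 :* t :^ 3
                                             :+ con 2 :* t :^ 4)
                   := con 3 :* (((con 2 :+ t) :* (con 1 :+ t)) :^ 2 :+ ((con 1 :+ t) :^ 2 :+ con 1))) refl t ⟩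
    3 * ((suc (suc t) * suc t) ^ 2 + (suc t ^ 2 + 1))
      ≡⟨ cong (3 *_) (degreeFactorSquareSum≡ r (suc t) r²≡2+t) ⟨
    3 * degreeFactorSquareSum r ∎
    where
    open ≤-Reasoning
    t : ℕ
    t = pred (pred (r ^ 2))
    r²≡2+t : r ^ 2 ≡ 2 + t
    r²≡2+t = refl

  squareSumPolynomial : ℕ → ℤ
  squareSumPolynomial r = + (r ^ 8) - + 2 ℤ.* + (r ^ 6) ℤ.+ + 2 ℤ.* + (r ^ 4) - + 2 ℤ.* + (r ^ 2) ℤ.+ + 2

  degreeFactorSquareSum-ℤ : ∀ r .{{_ : NonZero r}} → + degreeFactorSquareSum r ≡ squareSumPolynomial r
  degreeFactorSquareSum-ℤ r = begin
    + S
      ≡⟨ isolate (+ S) (+ 2 ℤ.* + (r ^ 6)) (+ 2 ℤ.* + (r ^ 2)) ⟩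
    + S ℤ.+ + 2 ℤ.* + (r ^ 6) ℤ.+ + 2 ℤ.* + (r ^ 2) - + 2 ℤ.* + (r ^ 6) - + 2 ℤ.* + (r ^ 2)
      ≡⟨ cong (λ z → z - + 2 ℤ.* + (r ^ 6) - + 2 ℤ.* + (r ^ 2)) identity-ℤ ⟩
    + (r ^ 8) ℤ.+ + 2 ℤ.* + (r ^ 4) ℤ.+ + 2 - + 2 ℤ.* + (r ^ 6) - + 2 ℤ.* + (r ^ 2)
      ≡⟨ rearrange (+ (r ^ 8)) (+ (r ^ 6)) (+ (r ^ 4)) (+ (r ^ 2)) ⟩
    squareSumPolynomial r ∎
    where
    open ≡-Reasoning
    S : ℕ
    S = degreeFactorSquareSum r
    identity-ℤ : + S ℤ.+ + 2 ℤ.* + (r ^ 6) ℤ.+ + 2 ℤ.* + (r ^ 2) ≡ + (r ^ 8) ℤ.+ + 2 ℤ.* + (r ^ 4) ℤ.+ + 2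
    identity-ℤ = begin
      + S ℤ.+ + 2 ℤ.* + (r ^ 6) ℤ.+ + 2 ℤ.* + (r ^ 2)
        ≡⟨ cong₂ (λ a b → + S ℤ.+ a ℤ.+ b) (ℤ.pos-* 2 (r ^ 6)) (ℤ.pos-* 2 (r ^ 2)) ⟨
      + (S + 2 * r ^ 6 + 2 * r ^ 2)
        ≡⟨ cong +_ (degreeFactorSquareSum-identity r) ⟩
      + (r ^ 8 + 2 * r ^ 4 + 2)
        ≡⟨ cong (λ a → + (r ^ 8) ℤ.+ a ℤ.+ + 2) (ℤ.pos-* 2 (r ^ 4)) ⟩
      + (r ^ 8) ℤ.+ + 2 ℤ.* + (r ^ 4) ℤ.+ + 2 ∎
    isolate : ∀ x y z → x ≡ x ℤ.+ y ℤ.+ z - y - z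
    isolate = ℤ-Solver.solve-∀
    rearrange : ∀ a b c d → a ℤ.+ + 2 ℤ.* c ℤ.+ + 2 - + 2 ℤ.* b - + 2 ℤ.* d
                          ≡ a - + 2 ℤ.* b ℤ.+ + 2 ℤ.* c - + 2 ℤ.* d ℤ.+ + 2
    rearrange = ℤ-Solver.solve-∀

  [p²q²]²≡p⁴q⁴ : ∀ p q → (p ^ 2 * q ^ 2) * (p ^ 2 * q ^ 2) ≡ p ^ 4 * q ^ 4
  [p²q²]²≡p⁴q⁴ = solve 2 (λ p q → (p :^ 2 :* q :^ 2) :* (p :^ 2 :* q :^ 2) := p :^ 4 :* q :^ 4) refl

  [p²q²]⁴<9*degreeFactorSquareSums : ∀ {p q} → 2 ≤ p → 2 ≤ q → let N = (p ^ 2 * q ^ 2) * (p ^ 2 * q ^ 2) in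
                         N * N < 9 * (degreeFactorSquareSum p * degreeFactorSquareSum q)
  [p²q²]⁴<9*degreeFactorSquareSums {p} {q} 2≤p 2≤q = begin-strict
    ((p ^ 2 * q ^ 2) * (p ^ 2 * q ^ 2)) * ((p ^ 2 * q ^ 2) * (p ^ 2 * q ^ 2))
      ≡⟨ solve 2 (λ p q → ((p :^ 2 :* q :^ 2) :* (p :^ 2 :* q :^ 2)) :* ((p :^ 2 :* q :^ 2) :* (p :^ 2 :* q :^ 2))
                          := p :^ 8 :* q :^ 8) refl p q ⟩
    p ^ 8 * q ^ 8
      <⟨ *-mono-< (degreeFactorSquareSum-bound p 2≤p) (degreeFactorSquareSum-bound q 2≤q) ⟩
    (3 * degreeFactorSquareSum p) * (3 * degreeFactorSquareSum q)
      ≡⟨ solve 2 (λ a b → (con 3 :* a) :* (con 3 :* b) := con 9 :* (a :* b)) refl (degreeFactorSquareSum p) (degreeFactorSquareSum q) ⟩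
    9 * (degreeFactorSquareSum p * degreeFactorSquareSum q) ∎
    where open ≤-Reasoning

  -- M₁ / |V| < M₂ / |E| for M₁ = N + S, |V| = N + 9, M₂ = S and |E| = N, cleared of denominators.
  zagreb-ratio : ∀ N S → N * N < 9 * S → (N + S) * N < S * (N + 9)
  zagreb-ratio N S N²<9S = subst₂ _<_ (expandˡ N S) (expandʳ N S) (+-monoʳ-< (S * N) N²<9S)
    where
    expandˡ : ∀ N S → S * N + N * N ≡ (N + S) * N
    expandˡ = ℕ-Solver.solve-∀
    expandʳ : ∀ N S → S * N + 9 * S ≡ S * (N + 9)
    expandʳ = ℕ-Solver.solve-∀

open import Defs
open import Data.Nat using (ℕ; _<_; _>_; _^_)
import Data.Nat as ℕ
open import Data.Nat.Properties using (<⇒≢)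
open import Data.Nat.Primality using (Prime; prime⇒nonZero)
open import Data.Integer using (ℤ; +_; _+_; _-_; _*_)
open import Data.Integer.Properties using (pos-*)
open import Data.Integer.Tactic.RingSolver using (solve-∀)
open import Data.Fin using (Fin)
open import Algebra.Core using (Op₁; Op₂)
open import Algebra.Structures using (IsGroup)
open import Relation.Binary.PropositionalEquality
open import Data.Product using (_×_; _,_)
open GeneratedSubgroups using (module SGBProperties)
open PrimePowers using (prime>1)
open OrderTwoPrimePowers using (module CyclicOfOrderP^αQ^β)
open SquareSums

zagreb₂-expansion : ∀ (P2 P4 P6 P8 Q2 Q4 Q6 Q8 : ℤ) →
  (P8 - + 2 * P6 + + 2 * P4 - + 2 * P2 + + 2) * (Q8 - + 2 * Q6 + + 2 * Q4 - + 2 * Q2 + + 2)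
    ≡ P8 * Q8 - + 2 * P6 * Q8 - + 2 * P8 * Q6 - + 4 * P4 * Q6
      - + 4 * P6 * Q4 - + 2 * P2 * Q8 - + 2 * P8 * Q2 + + 2 * P4 * Q8
      + + 2 * P8 * Q4 + + 4 * P6 * Q6 + + 4 * P4 * Q4 + + 4 * P2 * Q6
      + + 4 * P6 * Q2 - + 4 * P2 * Q4 - + 4 * P4 * Q2 + + 4 * P2 * Q2
      + + 2 * Q8 + + 2 * P8 - + 4 * Q6 - + 4 * P6 + + 4 * Q4 + + 4 * P4
      - + 4 * P2 - + 4 * Q2 + + 4
zagreb₂-expansion = solve-∀

zagreb₁-expansion : ∀ (P2 P4 P6 P8 Q2 Q4 Q6 Q8 : ℤ) →
  P4 * Q4 + (P8 - + 2 * P6 + + 2 * P4 - + 2 * P2 + + 2) * (Q8 - + 2 * Q6 + + 2 * Q4 - + 2 * Q2 + + 2)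
    ≡ P8 * Q8 - + 2 * P6 * Q8 - + 2 * P8 * Q6 - + 4 * P4 * Q6
      - + 4 * P6 * Q4 - + 2 * P2 * Q8 - + 2 * P8 * Q2 + + 2 * P4 * Q8
      + + 2 * P8 * Q4 + + 4 * P6 * Q6 + + 5 * P4 * Q4 + + 4 * P2 * Q6
      + + 4 * P6 * Q2 - + 4 * P2 * Q4 - + 4 * P4 * Q2 + + 4 * P2 * Q2
      + + 2 * Q8 + + 2 * P8 - + 4 * Q6 - + 4 * P6 + + 4 * Q4 + + 4 * P4
      - + 4 * P2 - + 4 * Q2 + + 4
zagreb₁-expansion = solve-∀

mainTheorem6 : (p q : ℕ) → Prime p → Prime q → p < q →
  (_∙_ : Op₂ (Fin (p ^ 2 Data.Nat.* q ^ 2))) (ε : Fin (p ^ 2 Data.Nat.* q ^ 2))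
  (_⁻¹ : Op₁ (Fin (p ^ 2 Data.Nat.* q ^ 2))) →
  IsGroup _≡_ _∙_ ε _⁻¹ → IsCyclic _∙_ ε _⁻¹ →
  let open SGB _∙_ ε _⁻¹
      P : ℕ → ℤ
      P k = + (p ^ k)
      Q : ℕ → ℤ
      Q k = + (q ^ k)
  in (+ M₁ ≡ P 8 * Q 8 - + 2 * P 6 * Q 8 - + 2 * P 8 * Q 6 - + 4 * P 4 * Q 6
             - + 4 * P 6 * Q 4 - + 2 * P 2 * Q 8 - + 2 * P 8 * Q 2 + + 2 * P 4 * Q 8
             + + 2 * P 8 * Q 4 + + 4 * P 6 * Q 6 + + 5 * P 4 * Q 4 + + 4 * P 2 * Q 6
             + + 4 * P 6 * Q 2 - + 4 * P 2 * Q 4 - + 4 * P 4 * Q 2 + + 4 * P 2 * Q 2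
             + + 2 * Q 8 + + 2 * P 8 - + 4 * Q 6 - + 4 * P 6 + + 4 * Q 4 + + 4 * P 4
             - + 4 * P 2 - + 4 * Q 2 + + 4)
   × (+ M₂ ≡ P 8 * Q 8 - + 2 * P 6 * Q 8 - + 2 * P 8 * Q 6 - + 4 * P 4 * Q 6
             - + 4 * P 6 * Q 4 - + 2 * P 2 * Q 8 - + 2 * P 8 * Q 2 + + 2 * P 4 * Q 8
             + + 2 * P 8 * Q 4 + + 4 * P 6 * Q 6 + + 4 * P 4 * Q 4 + + 4 * P 2 * Q 6
             + + 4 * P 6 * Q 2 - + 4 * P 2 * Q 4 - + 4 * P 4 * Q 2 + + 4 * P 2 * Q 2
             + + 2 * Q 8 + + 2 * P 8 - + 4 * Q 6 - + 4 * P 6 + + 4 * Q 4 + + 4 * P 4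
             - + 4 * P 2 - + 4 * Q 2 + + 4)
   × (M₂ Data.Nat.* numVertices > M₁ Data.Nat.* numEdges)
mainTheorem6 p q p-prime q-prime p<q _∙_ ε _⁻¹ isGroup cyclic =
  trans (cong +_ M₁≡n²+degreeSquareSum) (trans (cong₂ _+_ +n² +degreeSquareSum)
    (zagreb₁-expansion (+ (p ^ 2)) (+ (p ^ 4)) (+ (p ^ 6)) (+ (p ^ 8)) (+ (q ^ 2)) (+ (q ^ 4)) (+ (q ^ 6)) (+ (q ^ 8)))) ,
  trans (cong +_ M₂≡degreeSquareSum) (trans +degreeSquareSum
    (zagreb₂-expansion (+ (p ^ 2)) (+ (p ^ 4)) (+ (p ^ 6)) (+ (p ^ 8)) (+ (q ^ 2)) (+ (q ^ 4)) (+ (q ^ 6)) (+ (q ^ 8)))) ,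
  subst₂ _<_ (sym (cong₂ ℕ._*_ M₁≡n²+degreeSquareSum numEdges≡n²))
             (sym (cong₂ ℕ._*_ M₂≡degreeSquareSum (trans numVertices≡n²+|subgroups| (cong (n² ℕ.+_) length-subgroups))))
             (zagreb-ratio n² degreeSquareSum (subst (λ S → n² ℕ.* n² < 9 ℕ.* S) (sym degreeSquareSum≡product)
               ([p²q²]⁴<9*degreeFactorSquareSums (prime>1 p-prime) (prime>1 q-prime))))
  where
  open SGB _∙_ ε _⁻¹
  open SGBProperties _∙_ ε _⁻¹
  open CyclicOfOrderP^αQ^β p-prime q-prime (<⇒≢ p<q) 2 2 _∙_ ε _⁻¹ isGroup cyclic
  n² : ℕ
  n² = (p ^ 2 ℕ.* q ^ 2) ℕ.* (p ^ 2 ℕ.* q ^ 2)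
  +n² : + n² ≡ + (p ^ 4) * + (q ^ 4)
  +n² = trans (cong +_ ([p²q²]²≡p⁴q⁴ p q)) (pos-* (p ^ 4) (q ^ 4))
  +degreeSquareSum : + degreeSquareSum ≡ squareSumPolynomial p * squareSumPolynomial q
  +degreeSquareSum = trans (cong +_ degreeSquareSum≡product) (trans (pos-* (degreeFactorSquareSum p) (degreeFactorSquareSum q))
    (cong₂ _*_ (degreeFactorSquareSum-ℤ p ⦃ prime⇒nonZero p-prime ⦄) (degreeFactorSquareSum-ℤ q ⦃ prime⇒nonZero q-prime ⦄)))
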